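{- Let $A$ be an $n\times n$ Dyck matrix, $B=(b_{i,j})=\psi(A)$ with columns $B_1,\dots,B_{2n}$, $P$ the positroid on $[2n]$ represented by $B$, $\sigma$ the decorated permutation associated to $P$, and $\pi=\sigma^{ -1}$. Let $J=\{j\in\{n+1,\dots,2n\}\mid B_j\neq B_{j-1}\}$ and let $\omega:[2n]\to[n]$ be $\omega(j)=\max\{i\mid b_{i,j}\neq 0\}$. Then for $i\in[2n]$, $\pi(i)=i+1$ if $n<i<2n$ and $i+1\notin J$; $\pi(i)=\omega(i)$ if $n<i<2n$ and $i+1\in J$, or $i=2n$; $\pi(i)=n+1$ if $i=1$; $\pi(i)=i-1$ if $1<i\le n$ and $i-1\notin\omega(J)$; $\pi(i)=j$ if $1<i\le n$ and $i-1=\omega(j)$ for some $j\in J$. The index $j$ in the final case is necessarily unique.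
   Context: An $n\times n$ $0/1$ matrix is a Dyck matrix if its zero entries form a right-justified Young diagram anchored at the upper-right corner and lying strictly above the main diagonal. For an $n\times n$ real matrix $A=(a_{i,j})$, $\psi(A)$ is the $n\times 2n$ matrix whose first $n$ columns form $I_n$ and whose column $n+j$ ($j\in[n]$) has entry $(-1)^{n-i}a_{n+1-i,j}$ in row $i$. The positroid represented by $B$ is the matroid on $[2n]$ whose bases are the $n$-subsets indexing linearly independent columns of $B$. For $i\in[2n]$, $<_i$ is the order $i<_i i+1<_i\dots<_i 2n<_i 1<_i\dots<_i i-1$, and $I_i$ is the lexicographically minimal basis with respect to $<_i$ (indices mod $2n$). The decorated permutation $\sigma$ associated to $P$ is defined by: if $I_{i+1}=(I_i\setminus\{i\})\cup\{j\}$ with $j\ne i$ then $\sigma(j)=i$; if $I_{i+1}=I_i$ then $i$ is a fixed point, marked clockwise if $i\notin I_i$ and counterclockwise if $i\in I_i$. -}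

module Defs where

-- Conventions: all indices are 0-based Fin values. A column c : Fin (n + n)
-- is the paper's column (toℕ c + 1); a row r : Fin n is the paper's row
-- (toℕ r + 1). Real entries are taken in ℚ (all entries are 0, ±1).

open import Data.Nat as ℕ using (ℕ; zero; suc; _+_; _∸_; _<ᵇ_)
open import Data.Bool using (Bool; true; false; if_then_else_)
open import Data.Fin using (Fin; toℕ; splitAt; opposite; _≟_)
import Data.Fin
open import Data.Fin.Subset using (Subset; _∈_; _∉_; _∪_; _-_; ⁅_⁆; ∣_∣)
open import Data.Vec using (Vec; []; _∷_)
open import Data.List using (List; []; _∷_; filterᵇ; upTo)
open import Data.Rational using (ℚ; 0ℚ; 1ℚ; -_; _*_)
import Data.Rational as Q
open import Data.Sum using (_⊎_; inj₁; inj₂)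
open import Data.Product using (_×_; ∃; ∃-syntax)
open import Relation.Nullary using (¬_; yes; no)
open import Relation.Binary.PropositionalEquality using (_≡_; _≢_)

sumFin : ∀ {m} → (Fin m → ℚ) → ℚ
sumFin {zero}  f = 0ℚ
sumFin {suc m} f = f Fin.zero Q.+ sumFin (λ k → f (Fin.suc k))
  where import Data.Fin as Fin

negOnePow : ℕ → ℚ
negOnePow zero    = 1ℚ
negOnePow (suc k) = - negOnePow k

-- Zero entries form a right-justified Young diagram anchored at the upper-right
-- corner (closed upward within a column and rightward within a row) lying
-- strictly above the main diagonal.

IsDyck : ∀ {n} → (Fin n → Fin n → ℚ) → Set
IsDyck {n} A =
  (∀ r c → A r c ≡ 0ℚ ⊎ A r c ≡ 1ℚ) ×
  (∀ r c → A r c ≡ 0ℚ → toℕ r ℕ.< toℕ c) ×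
  (∀ r r' c → A r c ≡ 0ℚ → toℕ r' ℕ.≤ toℕ r → A r' c ≡ 0ℚ) ×
  (∀ r c c' → A r c ≡ 0ℚ → toℕ c ℕ.≤ toℕ c' → A r c' ≡ 0ℚ)

-- Column n+j, paper row i = toℕ r + 1:
--   (-1)^(n-i) * a_{n+1-i, j};  paper row n+1-i is the 0-based row  opposite r.

psi : ∀ {n} → (Fin n → Fin n → ℚ) → Fin n → Fin (n + n) → ℚ
psi {n} A r c with splitAt n c
... | inj₁ c₀ with r ≟ c₀
...   | yes _ = 1ℚ
...   | no  _ = 0ℚ
psi {n} A r c | inj₂ j = negOnePow (n ∸ suc (toℕ r)) * A (opposite r) j

LinIndep : ∀ {n m} → (Fin n → Fin m → ℚ) → Subset m → Set
LinIndep {n} {m} B S =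
  ∀ (λc : Fin m → ℚ) → (∀ c → c ∉ S → λc c ≡ 0ℚ) →
  (∀ r → sumFin (λ c → λc c * B r c) ≡ 0ℚ) → ∀ c → λc c ≡ 0ℚ

IsBasis : ∀ {n m} → (Fin n → Fin m → ℚ) → Subset m → Set
IsBasis {n} B S = ∣ S ∣ ≡ n × LinIndep B S

-- membership by a natural number index (false if out of range)
memℕ : ∀ {m} → Subset m → ℕ → Bool
memℕ []      _       = false
memℕ (b ∷ v) zero    = b
memℕ (b ∷ v) (suc t) = memℕ v t

-- the (0-based) column that is k-th in the order <_a, for a, k < m
atRank : ℕ → ℕ → ℕ → ℕ
atRank m a k = if (a + k) <ᵇ m then a + k else (a + k) ∸ m

-- the <_i-ranks of the elements of S, in increasing order; this is the
-- <_i-sorted list of elements of S, each element replaced by its <_i-rank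
ranks : ∀ {m} → Fin m → Subset m → List ℕ
ranks {m} i S = filterᵇ (λ k → memℕ S (atRank m (toℕ i) k)) (upTo m)

data LexLeq : List ℕ → List ℕ → Set where
  lex-nil : ∀ {ys} → LexLeq [] ys
  lex-lt  : ∀ {x y xs ys} → x ℕ.< y → LexLeq (x ∷ xs) (y ∷ ys)
  lex-eq  : ∀ {x xs ys} → LexLeq xs ys → LexLeq (x ∷ xs) (x ∷ ys)

IsLexMinBasis : ∀ {n m} → (Fin n → Fin m → ℚ) → Fin m → Subset m → Set
IsLexMinBasis B i S =
  IsBasis B S × (∀ S' → IsBasis B S' → LexLeq (ranks i S) (ranks i S'))

next : ∀ {m} → Fin m → Fin m
next {suc m} i with suc (toℕ i) ℕ.<? suc m
... | yes p = Data.Fin.fromℕ< p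
... | no  _ = Data.Fin.zero

-- SigmaMaps N j i  means  σ(j) = i, per the definition:
--   I_{i+1} = (I_i ∖ {i}) ∪ {j}, j ≠ i  ⇒ σ(j) = i;
--   I_{i+1} = I_i                       ⇒ σ(i) = i.
-- (Decorations of fixed points are irrelevant to the statement.)

SigmaMaps : ∀ {m} → (Fin m → Subset m) → Fin m → Fin m → Set
SigmaMaps N j i =
  (j ≢ i × N (next i) ≡ (N i - i) ∪ ⁅ j ⁆) ⊎ (j ≡ i × N (next i) ≡ N i)

pos : ∀ {m} → Fin m → ℕ
pos c = suc (toℕ c)

InJ : ∀ {n} → (Fin n → Fin (n + n) → ℚ) → Fin (n + n) → Set
InJ {n} B c =
  n ℕ.< pos c × ∃[ c' ] (suc (toℕ c') ≡ toℕ c × ¬ (∀ r → B r c ≡ B r c'))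

IsOmega : ∀ {n m} → (Fin n → Fin m → ℚ) → Fin m → Fin n → Set
IsOmega B c r = B r c ≢ 0ℚ × (∀ r' → toℕ r ℕ.< toℕ r' → B r' c ≡ 0ℚ)

module Submission where

-- Indices are 0-based: left r is the identity column r and
-- right j is column n + j of B = ψ(A) (paper columns r + 1 and n + j + 1).
--
-- Let height j be the number of nonzero entries in column j of A.  Row r of
-- B reads row n - 1 - r of A, so right j is a signed indicator of the rows
-- [0, height j), and heights decrease weakly (module Heights).  Hence
-- right a - right b is a signed sum of the identity columns of the rows
-- covered by exactly one of a, b, and a set of columns in which every right
-- column has a "pivot" row is independent (PsiLinear).
--
-- The Grassmann necklace is then described explicitly (Necklace).  Each set is
-- independent, and every column outside it depends on earlier columns of the
-- set (Bases); a general greedy criterion for lexicographically minimal bases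
-- (LexMin) identifies the sets with the I_c.  Consecutive sets differ by the
-- exchange of one column (Transitions), which also shows that they all have
-- n elements (Identification).  The exchanged columns give σ, and the seven
-- clauses translate them into the paper's notation: J, ω and positions
-- (Clauses).

open import Defs
open import Data.Nat using (ℕ)
open import Data.Fin using (Fin)
open import Data.Fin.Subset using (Subset)
open import Data.Rational using (ℚ)

module Prelims where

  open import Defs using (sumFin)
  open import Data.Nat as ℕ using (ℕ; zero; suc; _<_; _≤_; z≤n; s≤s)
  import Data.Nat.Properties as ℕP
  open import Data.Bool using (true)
  open import Data.Fin as F using (Fin; toℕ; fromℕ<; _↑ˡ_; _↑ʳ_)
  import Data.Fin.Properties as FP
  open import Data.Rational using (ℚ; 0ℚ; _*_; _+_; _-_)
  import Data.Rational.Properties as ℚP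
  open import Data.Rational.Solver using (module +-*-Solver)
  open import Data.Product using (Σ; _×_; _,_)
  open import Data.Sum using (_⊎_; inj₁; inj₂)
  open import Data.Fin.Subset using (Subset; _∈_; _∉_; _∪_; ⁅_⁆; ∣_∣; inside; outside)
    renaming (_-_ to _∖_)
  import Data.Fin.Subset.Properties as SP
  open import Data.Vec using (_∷_)
  open import Data.Vec.Base using (here; there)
  import Data.Vec.Properties as VP
  open import Function using (_∘_)
  open import Relation.Nullary using (Dec; yes; no; does; ¬_; contradiction)
  open import Level using (0ℓ)
  open import Relation.Unary using (Pred; Decidable)
  open import Relation.Binary.PropositionalEquality

  sumFin-cong : ∀ {k} {f g : Fin k → ℚ} → (∀ x → f x ≡ g x) → sumFin f ≡ sumFin g
  sumFin-cong {zero}  h = refl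
  sumFin-cong {suc k} h = cong₂ _+_ (h F.zero) (sumFin-cong (h ∘ F.suc))

  sumFin-zero : ∀ {k} {f : Fin k → ℚ} → (∀ x → f x ≡ 0ℚ) → sumFin f ≡ 0ℚ
  sumFin-zero {zero}  h = refl
  sumFin-zero {suc k} h rewrite h F.zero | sumFin-zero (h ∘ F.suc) = refl

  sumFin-single : ∀ {k} (f : Fin k → ℚ) (x : Fin k) → (∀ y → y ≢ x → f y ≡ 0ℚ) → sumFin f ≡ f x
  sumFin-single {suc k} f F.zero h
    rewrite sumFin-zero {f = f ∘ F.suc} (λ y → h (F.suc y) λ ()) = ℚP.+-identityʳ (f F.zero)
  sumFin-single {suc k} f (F.suc x) h rewrite h F.zero (λ ()) =
    trans (ℚP.+-identityˡ _)
          (sumFin-single (f ∘ F.suc) x (λ y y≢x → h (F.suc y) (y≢x ∘ FP.suc-injective)))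

  sumFin-split : ∀ p {q} (f : Fin (p ℕ.+ q) → ℚ) →
                 sumFin f ≡ sumFin (f ∘ (_↑ˡ q)) + sumFin (f ∘ (p ↑ʳ_))
  sumFin-split zero    f = sym (ℚP.+-identityˡ _)
  sumFin-split (suc p) f =
    trans (cong (f F.zero +_) (sumFin-split p (f ∘ F.suc))) (sym (ℚP.+-assoc (f F.zero) _ _))

  sumFin-scale : ∀ {k} (c : ℚ) (f : Fin k → ℚ) → sumFin (λ x → c * f x) ≡ c * sumFin f
  sumFin-scale {zero}  c f = sym (ℚP.*-zeroʳ c)
  sumFin-scale {suc k} c f =
    trans (cong (c * f F.zero +_) (sumFin-scale c (f ∘ F.suc)))
          (sym (ℚP.*-distribˡ-+ c (f F.zero) _))

  sumFin-sub : ∀ {k} (f g : Fin k → ℚ) → sumFin (λ x → f x - g x) ≡ sumFin f - sumFin g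
  sumFin-sub {zero}  f g = refl
  sumFin-sub {suc k} f g =
    trans (cong ((f F.zero - g F.zero) +_) (sumFin-sub (f ∘ F.suc) (g ∘ F.suc)))
          (regroup (f F.zero) (g F.zero) (sumFin (f ∘ F.suc)) (sumFin (g ∘ F.suc)))
    where
    open +-*-Solver
    regroup : ∀ a b c d → (a - b) + (c - d) ≡ (a + c) - (b + d)
    regroup = solve 4 (λ a b c d → (a :- b) :+ (c :- d) := (a :+ c) :- (b :+ d)) refl

  does-true : ∀ {A : Set} (a? : Dec A) → does a? ≡ true → A
  does-true (yes a) _ = a

  finAt : ∀ {k} v → v < k → Σ (Fin k) λ x → toℕ x ≡ v
  finAt v v<k = fromℕ< v<k , FP.toℕ-fromℕ< v<k

  predecessor : ∀ {k} (x : Fin k) → 0 < toℕ x → Σ (Fin k) λ x' → toℕ x ≡ suc (toℕ x')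
  predecessor (F.suc x) _ = F.inject₁ x , cong suc (sym (FP.toℕ-inject₁ x))

  nonempty : ∀ {k} → Fin (k ℕ.+ k) → 0 < k
  nonempty {suc k} _ = s≤s z≤n

  -- For a
  -- downward closed predicate the count is the length of the prefix on which it
  -- holds; this is how column heights and their "covers" are measured below.

  count : ∀ {k} {P : Pred (Fin k) 0ℓ} → Decidable P → ℕ
  count {zero}  P? = 0
  count {suc k} P? with P? F.zero
  ... | yes _ = suc (count (P? ∘ F.suc))
  ... | no  _ = count (P? ∘ F.suc)

  DownClosed : ∀ {k} → Pred (Fin k) 0ℓ → Set
  DownClosed P = ∀ {r r'} → P r → toℕ r' ≤ toℕ r → P r'

  count≤ : ∀ {k} {P : Pred (Fin k) 0ℓ} (P? : Decidable P) → count P? ≤ k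
  count≤ {zero}  P? = z≤n
  count≤ {suc k} P? with P? F.zero
  ... | yes _ = s≤s (count≤ (P? ∘ F.suc))
  ... | no  _ = ℕP.m≤n⇒m≤1+n (count≤ (P? ∘ F.suc))

  count-none : ∀ {k} {P : Pred (Fin k) 0ℓ} (P? : Decidable P) → (∀ r → ¬ P r) → count P? ≡ 0
  count-none {zero}  P? none = refl
  count-none {suc k} P? none with P? F.zero
  ... | yes p = contradiction p (none F.zero)
  ... | no  _ = count-none (P? ∘ F.suc) (none ∘ F.suc)

  count-above : ∀ {k} {P : Pred (Fin k) 0ℓ} (P? : Decidable P) → DownClosed P →
                ∀ {r} → P r → toℕ r < count P?
  count-above {suc k} P? dc {r} pr with P? F.zero
  count-above {suc k} P? dc {F.zero}  pr | yes _  = s≤s z≤n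
  count-above {suc k} P? dc {F.suc r} pr | yes _  =
    s≤s (count-above (P? ∘ F.suc) (λ p le → dc p (s≤s le)) pr)
  ... | no ¬p0 = contradiction (dc pr z≤n) ¬p0

  count-below : ∀ {k} {P : Pred (Fin k) 0ℓ} (P? : Decidable P) → DownClosed P →
                ∀ {r} → toℕ r < count P? → P r
  count-below {suc k} {P} P? dc {r} lt with P? F.zero
  count-below {suc k} P? dc {F.zero}  lt | yes p0 = p0
  count-below {suc k} P? dc {F.suc r} lt | yes _  =
    count-below (P? ∘ F.suc) (λ p le → dc p (s≤s le)) (ℕP.≤-pred lt)
  ... | no ¬p0 = contradiction (subst (toℕ r <_) (count-none (P? ∘ F.suc) none) lt) λ ()
    where
    none : ∀ r → ¬ P (F.suc r)
    none r p = ¬p0 (dc p z≤n)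

  count-unique : ∀ {k} {P : Pred (Fin k) 0ℓ} (P? : Decidable P) → DownClosed P →
                 ∀ z → z ≤ k → (∀ r → P r → toℕ r < z) → (∀ r → toℕ r < z → P r) →
                 count P? ≡ z
  count-unique {k} P? dc z z≤k only all = ℕP.≤-antisym
    (ℕP.≮⇒≥ λ z<c → let (r , r≡z) = finAt z (ℕP.<-≤-trans z<c (count≤ P?))
                     in ℕP.<-irrefl r≡z (only r (count-below P? dc (subst (_< count P?) (sym r≡z) z<c))))
    (ℕP.≮⇒≥ λ c<z → let (r , r≡c) = finAt (count P?) (ℕP.<-≤-trans c<z z≤k)
                     in ℕP.<-irrefl r≡c (count-above P? dc (all r (subst (_< z) (sym r≡c) c<z))))

  x∉p-x : ∀ {m} (S : Subset m) x → x ∉ S ∖ x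
  x∉p-x (_ ∷ S) (F.suc x) (there x∈) = x∉p-x S x x∈

  ∈-exchange⁻ : ∀ {m} {S : Subset m} {c y x} → x ∈ (S ∖ c) ∪ ⁅ y ⁆ → (x ∈ S × x ≢ c) ⊎ x ≡ y
  ∈-exchange⁻ {S = S} {c} {y} x∈ with SP.x∈p∪q⁻ (S ∖ c) ⁅ y ⁆ x∈
  ... | inj₁ x∈S-c = inj₁ (SP.p─q⊆p S ⁅ c ⁆ x∈S-c , λ { refl → x∉p-x S _ x∈S-c })
  ... | inj₂ x∈⁅y⁆ = inj₂ (SP.x∈⁅y⁆⇒x≡y y x∈⁅y⁆)

  ∈-exchange⁺ : ∀ {m} {S : Subset m} {c y x} → x ∈ S → x ≢ c → x ∈ (S ∖ c) ∪ ⁅ y ⁆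
  ∈-exchange⁺ x∈S x≢c = SP.x∈p∪q⁺ (inj₁ (SP.x∈p∧x≢y⇒x∈p-y x∈S x≢c))

  ∈-exchange-new : ∀ {m} {S : Subset m} {c} y → y ∈ (S ∖ c) ∪ ⁅ y ⁆
  ∈-exchange-new y = SP.x∈p∪q⁺ (inj₂ (SP.x∈⁅x⁆ y))

  ∣p-x∣ : ∀ {m} (S : Subset m) {x} → x ∈ S → suc ∣ S ∖ x ∣ ≡ ∣ S ∣
  ∣p-x∣ (inside ∷ S) here = cong suc (cong ∣_∣ (VP.zipWith-identityʳ (λ _ → refl) S))
  ∣p-x∣ (inside  ∷ S) (there x∈) = cong suc (∣p-x∣ S x∈)
  ∣p-x∣ (outside ∷ S) (there x∈) = ∣p-x∣ S x∈

  ∣p∪⁅y⁆∣ : ∀ {m} (S : Subset m) {y} → y ∉ S → ∣ S ∪ ⁅ y ⁆ ∣ ≡ suc ∣ S ∣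
  ∣p∪⁅y⁆∣ (inside  ∷ S) {F.zero}  y∉ = contradiction here y∉
  ∣p∪⁅y⁆∣ (outside ∷ S) {F.zero}  y∉ rewrite SP.∪-identityʳ S = refl
  ∣p∪⁅y⁆∣ (inside  ∷ S) {F.suc y} y∉ = cong suc (∣p∪⁅y⁆∣ S (y∉ ∘ there))
  ∣p∪⁅y⁆∣ (outside ∷ S) {F.suc y} y∉ = ∣p∪⁅y⁆∣ S (y∉ ∘ there)

  ∣exchange∣ : ∀ {m} (S : Subset m) {c y} → c ∈ S → y ∉ S → ∣ (S ∖ c) ∪ ⁅ y ⁆ ∣ ≡ ∣ S ∣
  ∣exchange∣ S {c} c∈S y∉S =
    trans (∣p∪⁅y⁆∣ (S ∖ c) (y∉S ∘ SP.p─q⊆p S ⁅ c ⁆)) (∣p-x∣ S c∈S)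

module LexMin where

  open Prelims using (finAt)
  open import Data.Nat as ℕ using (ℕ; zero; suc; _+_; _∸_; _<_; _≤_; _<ᵇ_; _<?_)
  import Data.Nat.Properties as ℕP
  open import Data.Bool using (Bool; true; false; if_then_else_; T)
  open import Data.Fin as F using (Fin; toℕ)
  import Data.Fin.Properties as FP
  open import Data.Fin.Subset using (Subset; _∈_; _∉_; _⊆_)
  import Data.Fin.Subset.Properties as SP
  open import Data.Vec using (_∷_; lookup)
  import Data.Vec.Properties as VP
  open import Data.List using (List; _∷_; filterᵇ; upTo)
  open import Data.List.Membership.Propositional using () renaming (_∈_ to _∈ˡ_)
  open import Data.List.Relation.Unary.Any using (here; there)
  import Data.List.Relation.Unary.All as All
  open import Data.List.Relation.Unary.AllPairs using (AllPairs; _∷_)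
  import Data.List.Relation.Unary.AllPairs.Properties as AllPairsP
  import Data.List.Relation.Unary.Any.Properties as AnyP
  open import Data.Rational using (ℚ; 0ℚ; _*_)
  import Data.Rational as ℚ
  open import Data.Product using (Σ; _×_; _,_; proj₁; proj₂)
  open import Data.Unit using (tt)
  open import Function using (id)
  open import Relation.Nullary using (yes; no; ¬_; contradiction)
  open import Relation.Binary using (tri<; tri≈; tri>)
  open import Relation.Binary.PropositionalEquality

  <ᵇ-true : ∀ {m n} → m < n → (m <ᵇ n) ≡ true
  <ᵇ-true {m} {n} m<n with m <ᵇ n | ℕP.<⇒<ᵇ m<n
  ... | true | _ = refl

  <ᵇ-false : ∀ {m n} → n ≤ m → (m <ᵇ n) ≡ false
  <ᵇ-false {m} {n} n≤m with m <ᵇ n in eq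
  ... | false = refl
  ... | true  = contradiction n≤m (ℕP.<⇒≱ (ℕP.<ᵇ⇒< m n (subst T (sym eq) tt)))

  -- The rank of c in the cyclic order <_a on [0, m): a has rank 0, m - 1 has
  -- rank m - 1 - a, and 0 comes right after it.  It inverts Defs.atRank.

  rank : ℕ → ℕ → ℕ → ℕ
  rank m a c = if c <ᵇ a then (m ∸ a) + c else c ∸ a

  atRank<m : ∀ m a k → a < m → k < m → atRank m a k < m
  atRank<m m a k a<m k<m with (a + k) <ᵇ m in eq
  ... | true  = ℕP.<ᵇ⇒< (a + k) m (subst T (sym eq) tt)
  ... | false = ℕP.≤-<-trans (ℕP.m≤n+o⇒m∸n≤o (a + k) m (ℕP.+-monoˡ-≤ k (ℕP.<⇒≤ a<m))) k<m

  rank<m : ∀ m a c → a < m → c < m → rank m a c < m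
  rank<m m a c a<m c<m with c <? a
  ... | yes c<a rewrite <ᵇ-true c<a =
    subst (m ∸ a + c <_) (trans (ℕP.+-comm (m ∸ a) a) (ℕP.m+[n∸m]≡n (ℕP.<⇒≤ a<m)))
          (ℕP.+-monoʳ-< (m ∸ a) c<a)
  ... | no c≮a rewrite <ᵇ-false {c} {a} (ℕP.≮⇒≥ c≮a) = ℕP.≤-<-trans (ℕP.m∸n≤m c a) c<m

  atRank-rank : ∀ m a c → a < m → c < m → atRank m a (rank m a c) ≡ c
  atRank-rank m a c a<m c<m with c <? a
  ... | yes c<a rewrite <ᵇ-true c<a =
    trans (cong (λ z → if z <ᵇ m then z else z ∸ m) a+[m∸a+c])
          (trans (cong (λ b → if b then m + c else m + c ∸ m) (<ᵇ-false (ℕP.m≤m+n m c)))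
                 (ℕP.m+n∸m≡n m c))
    where
    a+[m∸a+c] : a + (m ∸ a + c) ≡ m + c
    a+[m∸a+c] = trans (sym (ℕP.+-assoc a (m ∸ a) c)) (cong (_+ c) (ℕP.m+[n∸m]≡n (ℕP.<⇒≤ a<m)))
  ... | no c≮a rewrite <ᵇ-false {c} {a} (ℕP.≮⇒≥ c≮a) | ℕP.m+[n∸m]≡n (ℕP.≮⇒≥ c≮a)
                   | <ᵇ-true c<m = refl

  rank-atRank : ∀ m a k → a < m → k < m → rank m a (atRank m a k) ≡ k
  rank-atRank m a k a<m k<m with (a + k) <ᵇ m in eq
  ... | true rewrite <ᵇ-false {a + k} {a} (ℕP.m≤m+n a k) = ℕP.m+n∸m≡n a k
  ... | false = wrapped
    where
    open ≡-Reasoning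
    m≤a+k : m ≤ a + k
    m≤a+k = ℕP.≮⇒≥ λ lt → subst T eq (ℕP.<⇒<ᵇ lt)
    d : ℕ
    d = a + k ∸ m
    d<a : d < a
    d<a = ℕP.+-cancelʳ-< m d a
            (subst (_< a + m) (sym (ℕP.m∸n+n≡m m≤a+k)) (ℕP.+-monoʳ-< a k<m))
    wrapped : rank m a d ≡ k
    wrapped rewrite <ᵇ-true d<a = ℕP.+-cancelˡ-≡ a (m ∸ a + d) k (begin
      a + (m ∸ a + d)  ≡⟨ sym (ℕP.+-assoc a (m ∸ a) d) ⟩
      a + (m ∸ a) + d  ≡⟨ cong (_+ d) (ℕP.m+[n∸m]≡n (ℕP.<⇒≤ a<m)) ⟩
      m + d            ≡⟨ ℕP.+-comm m d ⟩
      d + m            ≡⟨ ℕP.m∸n+n≡m m≤a+k ⟩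
      a + k            ∎)

  -- Ranks are compared through the "unrolled" position of c, which adds m to
  -- the columns preceding a; the rank is the unrolled position minus a.

  unrolled : ℕ → ℕ → ℕ → ℕ
  unrolled m a c = if c <ᵇ a then m + c else c

  unrolled-before : ∀ m a c → c < a → unrolled m a c ≡ m + c
  unrolled-before m a c c<a rewrite <ᵇ-true c<a = refl

  unrolled-after : ∀ m a c → a ≤ c → unrolled m a c ≡ c
  unrolled-after m a c a≤c rewrite <ᵇ-false {c} {a} a≤c = refl

  rank+a : ∀ m a c → a ≤ m → rank m a c + a ≡ unrolled m a c
  rank+a m a c a≤m with c <? a
  ... | yes c<a rewrite <ᵇ-true c<a =
    trans (ℕP.+-assoc (m ∸ a) c a)
          (trans (cong (m ∸ a +_) (ℕP.+-comm c a))
                 (trans (sym (ℕP.+-assoc (m ∸ a) a c)) (cong (_+ c) (ℕP.m∸n+n≡m a≤m))))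
  ... | no c≮a rewrite <ᵇ-false {c} {a} (ℕP.≮⇒≥ c≮a) = ℕP.m∸n+n≡m (ℕP.≮⇒≥ c≮a)

  rank-< : ∀ m a c c' → a ≤ m → unrolled m a c < unrolled m a c' → rank m a c < rank m a c'
  rank-< m a c c' a≤m lt =
    ℕP.+-cancelʳ-< a _ _ (subst₂ _<_ (sym (rank+a m a c a≤m)) (sym (rank+a m a c' a≤m)) lt)

  filterᵇ-head : ∀ (q : ℕ → Bool) L z → z ∈ˡ L → q z ≡ true →
                 Σ ℕ λ w → Σ (List ℕ) λ ws → filterᵇ q L ≡ w ∷ ws × w ∈ˡ L
  filterᵇ-head q (y ∷ L) z z∈ qz with q y in qy
  ... | true = y , filterᵇ q L , refl , here refl
  filterᵇ-head q (y ∷ L) z (here refl)  qz | false = contradiction (trans (sym qz) qy) λ ()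
  filterᵇ-head q (y ∷ L) z (there z∈L) qz | false with filterᵇ-head q L z z∈L qz
  ... | w , ws , eq , w∈ = w , ws , eq , there w∈

  filterᵇ-keep : ∀ (p : ℕ → Bool) y L → p y ≡ true → filterᵇ p (y ∷ L) ≡ y ∷ filterᵇ p L
  filterᵇ-keep p y L py rewrite py = refl

  filterᵇ-drop : ∀ (p : ℕ → Bool) y L → p y ≡ false → filterᵇ p (y ∷ L) ≡ filterᵇ p L
  filterᵇ-drop p y L py rewrite py = refl

  lex-tail : ∀ {y xs ys} → LexLeq (y ∷ xs) (y ∷ ys) → LexLeq xs ys
  lex-tail (lex-lt y<y) = contradiction y<y (ℕP.<-irrefl refl)
  lex-tail (lex-eq l)   = l

  lex-head : ∀ {w x xs ys} → LexLeq (w ∷ xs) (x ∷ ys) → ¬ x < w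
  lex-head (lex-lt w<x) x<w = ℕP.<-asym w<x x<w
  lex-head (lex-eq _)   x<x = ℕP.<-irrefl refl x<x

  lex-nothing-after : ∀ (p q : ℕ → Bool) (L : List ℕ) → AllPairs _<_ L →
    LexLeq (filterᵇ q L) (filterᵇ p L) →
    ∀ x → x ∈ˡ L → (∀ y → y ∈ˡ L → y < x → p y ≡ q y) → p x ≡ true → q x ≡ false →
    ∀ z → z ∈ˡ L → x < z → q z ≡ false
  lex-nothing-after p q (y ∷ L) sorted lex .y (here refl) agree px qx .y (here refl) y<y =
    contradiction y<y (ℕP.<-irrefl refl)
  lex-nothing-after p q (y ∷ L) (y<L ∷ _) lex .y (here refl) agree px qx z (there z∈L) y<z
    with q z in qz
  ... | false = refl
  ... | true with filterᵇ-head q L z z∈L qz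
  ...   | w , ws , eq , w∈L =
    contradiction (All.lookup y<L w∈L)
      (lex-head (subst₂ LexLeq (trans (filterᵇ-drop q y L qx) eq) (filterᵇ-keep p y L px) lex))
  lex-nothing-after p q (y ∷ L) (y<L ∷ sorted) lex x (there x∈L) agree px qx z z∈ x<z
    with z∈
  ... | here refl  = contradiction x<z (ℕP.<-asym (All.lookup y<L x∈L))
  ... | there z∈L  = lex-nothing-after p q L sorted lexL x x∈L (λ y' y'∈ → agree y' (there y'∈))
                       px qx z z∈L x<z
    where
    py≡qy : p y ≡ q y
    py≡qy = agree y (here refl) (All.lookup y<L x∈L)
    lexL : LexLeq (filterᵇ q L) (filterᵇ p L)
    lexL = drop-head (p y) refl
      where
      drop-head : ∀ b → p y ≡ b → LexLeq (filterᵇ q L) (filterᵇ p L)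
      drop-head true  py = lex-tail (subst₂ LexLeq (filterᵇ-keep q y L (trans (sym py≡qy) py))
                                                   (filterᵇ-keep p y L py) lex)
      drop-head false py = subst₂ LexLeq (filterᵇ-drop q y L (trans (sym py≡qy) py))
                                         (filterᵇ-drop p y L py) lex

  upTo-sorted : ∀ m → AllPairs _<_ (upTo m)
  upTo-sorted m = AllPairsP.applyUpTo⁺₁ id m (λ i<j _ → i<j)

  upTo-∈ : ∀ {m k} → k < m → k ∈ˡ upTo m
  upTo-∈ k<m = AnyP.applyUpTo⁺ id refl k<m

  memℕ-lookup : ∀ {m} (S : Subset m) x → memℕ S (toℕ x) ≡ lookup S x
  memℕ-lookup (b ∷ S) F.zero    = refl
  memℕ-lookup (b ∷ S) (F.suc x) = memℕ-lookup S x

  lookup⇒∈ : ∀ {m} {S : Subset m} {x} → lookup S x ≡ true → x ∈ S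
  lookup⇒∈ {S = S} {x} = VP.lookup⇒[]= x S

  lookup⇒∉ : ∀ {m} {S : Subset m} {x} → lookup S x ≡ false → x ∉ S
  lookup⇒∉ e x∈S = contradiction (trans (sym (VP.[]=⇒lookup x∈S)) e) λ ()

  lookup-∉ : ∀ {m} {S : Subset m} {x} → x ∉ S → lookup S x ≡ false
  lookup-∉ {S = S} {x} x∉S with lookup S x in Sx
  ... | false = refl
  ... | true  = contradiction (lookup⇒∈ Sx) x∉S

  -- If T is a basis and every column
  -- x outside T is a combination of x itself and columns of T preceding x in
  -- <_i, then T is the only lexicographically minimal basis: comparing ranks
  -- one by one, a lex-minimal N cannot take a column x ∉ T (its earlier
  -- columns would already make x dependent) and cannot skip a column of T
  -- (it would then be a proper subset of T).

  module Greedy {n m : ℕ} (B : Fin n → Fin m → ℚ) (i : Fin m) where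

    rankOf : Fin m → ℕ
    rankOf c = rank m (toℕ i) (toℕ c)

    EarlierDependence : Subset m → Fin m → Set
    EarlierDependence T x = Σ (Fin m → ℚ) λ λc → (λc x ≢ 0ℚ) ×
      (∀ c → λc c ≢ 0ℚ → c ≢ x → c ∈ T × rankOf c < rankOf x) ×
      (∀ r → sumFin (λ c → λc c * B r c) ≡ 0ℚ)

    module _ (T N : Subset m) (basisT : IsBasis B T)
             (dependent : ∀ x → x ∉ T → EarlierDependence T x)
             (lexMinN : IsLexMinBasis B i N) where

      private
        a : ℕ
        a = toℕ i
        a<m : a < m
        a<m = FP.toℕ<n i

      inT? inN? : ℕ → Bool
      inT? k = memℕ T (atRank m a k)
      inN? k = memℕ N (atRank m a k)

      mem-rank : ∀ (S : Subset m) c → memℕ S (atRank m a (rankOf c)) ≡ lookup S c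
      mem-rank S c = trans (cong (memℕ S) (atRank-rank m a (toℕ c) a<m (FP.toℕ<n c)))
                           (memℕ-lookup S c)

      columnAt : ∀ k → k < m →
                 Σ (Fin m) λ x → rankOf x ≡ k × (∀ S → memℕ S (atRank m a k) ≡ lookup S x)
      columnAt k k<m = x , trans (cong (rank m a) x≡) (rank-atRank m a k a<m k<m) ,
                       λ S → trans (cong (memℕ S) (sym x≡)) (memℕ-lookup S x)
        where
        x : Fin m
        x = proj₁ (finAt (atRank m a k) (atRank<m m a k a<m k<m))
        x≡ : toℕ x ≡ atRank m a k
        x≡ = proj₂ (finAt (atRank m a k) (atRank<m m a k a<m k<m))

      -- If T and N agree below x, then N does not contain x ∉ T: the earlier
      -- dependence of x would be a dependence among columns of N.
      no-extra : ∀ x → (∀ k' → k' < rankOf x → inT? k' ≡ inN? k') → x ∉ T → x ∉ N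
      no-extra x below x∉T x∈N = nz (proj₂ (proj₁ lexMinN) λc outsideN rows x)
        where
        W : EarlierDependence T x
        W = dependent x x∉T
        λc : Fin m → ℚ
        λc = proj₁ W
        nz : λc x ≢ 0ℚ
        nz = proj₁ (proj₂ W)
        earlier : ∀ c → λc c ≢ 0ℚ → c ≢ x → c ∈ T × rankOf c < rankOf x
        earlier = proj₁ (proj₂ (proj₂ W))
        rows : ∀ r → sumFin (λ c → λc c * B r c) ≡ 0ℚ
        rows = proj₂ (proj₂ (proj₂ W))
        outsideN : ∀ c → c ∉ N → λc c ≡ 0ℚ
        outsideN c c∉N with λc c ℚ.≟ 0ℚ | c F.≟ x
        ... | yes z  | _        = z
        ... | no _   | yes refl = contradiction x∈N c∉N
        ... | no λ≢0 | no c≢x   = contradiction (lookup⇒∈ (begin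
              lookup N c      ≡⟨ sym (mem-rank N c) ⟩
              inN? (rankOf c) ≡⟨ sym (below (rankOf c) (proj₂ (earlier c λ≢0 c≢x))) ⟩
              inT? (rankOf c) ≡⟨ mem-rank T c ⟩
              lookup T c      ≡⟨ VP.[]=⇒lookup (proj₁ (earlier c λ≢0 c≢x)) ⟩
              true            ∎)) c∉N
          where open ≡-Reasoning

      -- If T and N agree below x and x ∈ T, then x ∈ N: otherwise, by
      -- lex-minimality against T, N has no column after x either, so N ⊊ T.
      no-missing : ∀ x → (∀ k' → k' < rankOf x → inT? k' ≡ inN? k') → x ∈ T → x ∈ N
      no-missing x below x∈T with x SP.∈? N
      ... | yes x∈N = x∈N
      ... | no  x∉N = contradiction (trans (proj₁ (proj₁ lexMinN)) (sym (proj₁ basisT)))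
                                    (ℕP.<⇒≢ (SP.p⊂q⇒∣p∣<∣q∣ (N⊆T , x , x∈T , x∉N)))
        where
        k : ℕ
        k = rankOf x
        in-T : inT? k ≡ true
        in-T = trans (mem-rank T x) (VP.[]=⇒lookup x∈T)
        out-N : inN? k ≡ false
        out-N = trans (mem-rank N x) (lookup-∉ x∉N)
        after : ∀ z → z ∈ˡ upTo m → k < z → inN? z ≡ false
        after = lex-nothing-after inT? inN? (upTo m) (upTo-sorted m) (proj₂ lexMinN T basisT) k
                  (upTo-∈ (rank<m m a (toℕ x) a<m (FP.toℕ<n x))) (λ y _ y<k → below y y<k) in-T out-N
        N⊆T : N ⊆ T
        N⊆T {c} c∈N with ℕ.<-cmp (rankOf c) k
        ... | tri< lt _ _ = lookup⇒∈ (trans (sym (mem-rank T c))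
                              (trans (below (rankOf c) lt) (trans (mem-rank N c) (VP.[]=⇒lookup c∈N))))
        ... | tri≈ _ eq _ = contradiction c∈N (lookup⇒∉ (trans (sym (mem-rank N c)) (trans (cong inN? eq) out-N)))
        ... | tri> _ _ gt = contradiction c∈N (lookup⇒∉ (trans (sym (mem-rank N c))
                              (after (rankOf c) (upTo-∈ (rank<m m a (toℕ c) a<m (FP.toℕ<n c))) gt)))

      agree-at : ∀ k → k < m → (∀ k' → k' < k → inT? k' ≡ inN? k') → inT? k ≡ inN? k
      agree-at k k<m below with columnAt k k<m
      ... | x , refl , mem with x SP.∈? T
      ...   | yes x∈T = trans (trans (mem T) (VP.[]=⇒lookup x∈T))
                              (sym (trans (mem N) (VP.[]=⇒lookup (no-missing x below x∈T))))
      ...   | no  x∉T = trans (trans (mem T) (lookup-∉ x∉T))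
                              (sym (trans (mem N) (lookup-∉ (no-extra x below x∉T))))

      agree-below : ∀ k → k ≤ m → ∀ k' → k' < k → inT? k' ≡ inN? k'
      agree-below (suc k) k<m k' k'<k with k' ℕ.≟ k
      ... | yes refl = agree-at k k<m (agree-below k (ℕP.<⇒≤ k<m))
      ... | no k'≢k  = agree-below k (ℕP.<⇒≤ k<m) k' (ℕP.≤∧≢⇒< (ℕP.≤-pred k'<k) k'≢k)

      greedy-lexMin : N ≡ T
      greedy-lexMin = SP.⊆-antisym (λ {c} c∈N → lookup⇒∈ (trans (sym (same c)) (VP.[]=⇒lookup c∈N)))
                                   (λ {c} c∈T → lookup⇒∈ (trans (same c) (VP.[]=⇒lookup c∈T)))
        where
        same : ∀ c → lookup N c ≡ lookup T c
        same c = trans (sym (mem-rank N c))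
                   (trans (sym (agree-below m ℕP.≤-refl (rankOf c) (rank<m m a (toℕ c) a<m (FP.toℕ<n c))))
                          (mem-rank T c))

module Heights (n : ℕ) (A : Fin n → Fin n → ℚ) (dyck : IsDyck A) where

  open Prelims
  open import Data.Nat using (suc; _+_; _∸_; _<_; _≤_; _<?_; z≤n; s≤s)
  import Data.Nat.Properties as ℕP
  open import Data.Fin as F using (toℕ; _↑ˡ_; _↑ʳ_; opposite)
  import Data.Fin.Properties as FP
  open import Data.Rational using (0ℚ; 1ℚ; _*_)
  import Data.Rational as ℚ
  import Data.Rational.Properties as ℚP
  open import Data.Product using (Σ; _,_; proj₁; proj₂)
  open import Data.Sum using (inj₁; inj₂)
  open import Relation.Nullary using (yes; no; ¬_; ¬?; contradiction)
  open import Relation.Binary.PropositionalEquality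

  B : Fin n → Fin (n + n) → ℚ
  B = psi A

  left : Fin n → Fin (n + n)
  left r = r ↑ˡ n

  right : Fin n → Fin (n + n)
  right j = n ↑ʳ j

  sign : Fin n → ℚ
  sign r = negOnePow (n ∸ suc (toℕ r))

  B-left-same : ∀ r → B r (left r) ≡ 1ℚ
  B-left-same r rewrite FP.splitAt-↑ˡ n r n with r F.≟ r
  ... | yes _   = refl
  ... | no  r≢r = contradiction refl r≢r

  B-left-other : ∀ r r' → r ≢ r' → B r (left r') ≡ 0ℚ
  B-left-other r r' r≢r' rewrite FP.splitAt-↑ˡ n r' n with r F.≟ r'
  ... | yes r≡r' = contradiction r≡r' r≢r'
  ... | no  _    = refl

  B-right : ∀ r j → B r (right j) ≡ sign r * A (opposite r) j
  B-right r j rewrite FP.splitAt-↑ʳ n n j = refl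

  zeros-above-diagonal : ∀ r c → A r c ≡ 0ℚ → toℕ r < toℕ c
  zeros-above-diagonal = proj₁ (proj₂ dyck)

  zeros-closed-up : ∀ r r' c → A r c ≡ 0ℚ → toℕ r' ≤ toℕ r → A r' c ≡ 0ℚ
  zeros-closed-up = proj₁ (proj₂ (proj₂ dyck))

  zeros-closed-right : ∀ r c c' → A r c ≡ 0ℚ → toℕ c ≤ toℕ c' → A r c' ≡ 0ℚ
  zeros-closed-right = proj₂ (proj₂ (proj₂ dyck))

  -- Row r of B reads row  opposite r  of A, so the nonzero entries of a column
  -- of A, which lie below a Young diagram of zeros, become a prefix of rows.

  Nonzero : Fin n → Fin n → Set
  Nonzero j r = A (opposite r) j ≢ 0ℚ

  opposite-anti : ∀ {r r' : Fin n} → toℕ r' ≤ toℕ r → toℕ (opposite r) ≤ toℕ (opposite r')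
  opposite-anti {r} {r'} r'≤r rewrite FP.opposite-prop r | FP.opposite-prop r' =
    ℕP.∸-monoʳ-≤ n (s≤s r'≤r)

  nonzero-down : ∀ j → DownClosed (Nonzero j)
  nonzero-down j nz r'≤r z = nz (zeros-closed-up _ _ j z (opposite-anti r'≤r))

  opaque
    height : Fin n → ℕ
    height j = count (λ r → ¬? (A (opposite r) j ℚ.≟ 0ℚ))

    height≤n : ∀ j → height j ≤ n
    height≤n j = count≤ _

    below-height : ∀ {r j} → Nonzero j r → toℕ r < height j
    below-height {j = j} = count-above _ (nonzero-down j)

    nonzero-below : ∀ {r j} → toℕ r < height j → Nonzero j r
    nonzero-below {j = j} = count-below _ (nonzero-down j)

    height-unique : ∀ j z → z ≤ n → (∀ r → Nonzero j r → toℕ r < z) → (∀ r → toℕ r < z → Nonzero j r) →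
                    height j ≡ z
    height-unique j = count-unique _ (nonzero-down j)

  entry-below : ∀ {r j} → toℕ r < height j → A (opposite r) j ≡ 1ℚ
  entry-below {r} {j} lt with proj₁ dyck (opposite r) j
  ... | inj₂ one  = one
  ... | inj₁ isZero = contradiction isZero (nonzero-below lt)

  entry-above : ∀ {r j} → height j ≤ toℕ r → A (opposite r) j ≡ 0ℚ
  entry-above {r} {j} ge with A (opposite r) j ℚ.≟ 0ℚ
  ... | yes z  = z
  ... | no  nz = contradiction ge (ℕP.<⇒≱ (below-height nz))

  B-right-below : ∀ {r j} → toℕ r < height j → B r (right j) ≡ sign r
  B-right-below {r} {j} lt =
    trans (B-right r j) (trans (cong (sign r *_) (entry-below lt)) (ℚP.*-identityʳ (sign r)))

  B-right-above : ∀ {r j} → height j ≤ toℕ r → B r (right j) ≡ 0ℚ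
  B-right-above {r} {j} ge =
    trans (B-right r j) (trans (cong (sign r *_) (entry-above ge)) (ℚP.*-zeroʳ (sign r)))

  -- Heights decrease weakly from left to right (zeros are closed rightward).
  height-anti : ∀ {j j'} → toℕ j ≤ toℕ j' → height j' ≤ height j
  height-anti {j} {j'} j≤j' = ℕP.≮⇒≥ λ hj<hj' →
    let (r , r≡hj) = finAt (height j) (ℕP.<-≤-trans hj<hj' (height≤n j'))
    in  nonzero-below (subst (_< height j') (sym r≡hj) hj<hj')
          (zeros-closed-right _ j j' (entry-above (ℕP.≤-reflexive (sym r≡hj))) j≤j')

  -- The diagonal entry keeps the last row of A nonzero, so every height is ≥ 1;
  -- the first column has no zeros at all.
  height≥1 : ∀ j → 1 ≤ height j
  height≥1 j = subst (_< height j) r₀≡0 (below-height nonzero)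
    where
    r₀ : Fin n
    r₀ = proj₁ (finAt 0 (ℕP.≤-<-trans z≤n (FP.toℕ<n j)))
    r₀≡0 : toℕ r₀ ≡ 0
    r₀≡0 = proj₂ (finAt 0 (ℕP.≤-<-trans z≤n (FP.toℕ<n j)))
    nonzero : Nonzero j r₀
    nonzero z = ℕP.<⇒≱ (zeros-above-diagonal _ j z)
      (subst (toℕ j ≤_) (sym (trans (FP.opposite-prop r₀) (cong (λ v → n ∸ suc v) r₀≡0)))
             (ℕP.m+n≤o⇒m≤o∸n (toℕ j) (subst (_≤ n) (ℕP.+-comm 1 (toℕ j)) (FP.toℕ<n j))))

  height-first : ∀ j → toℕ j ≡ 0 → height j ≡ n
  height-first j j≡0 = height-unique j n ℕP.≤-refl (λ r _ → FP.toℕ<n r)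
    (λ r _ z → ℕP.n≮0 (subst (toℕ (opposite r) <_) j≡0 (zeros-above-diagonal _ j z)))

  prevRow : ∀ {i} → 0 < i → i ≤ n → Σ (Fin n) λ ρ → suc (toℕ ρ) ≡ i
  prevRow {suc i} 0<i i≤n = F.fromℕ< i≤n , cong suc (FP.toℕ-fromℕ< i≤n)

  topRow : ∀ j → Σ (Fin n) λ ρ → suc (toℕ ρ) ≡ height j
  topRow j = prevRow (height≥1 j) (height≤n j)

  Taller : ℕ → Fin n → Set
  Taller v j = v < height j

  taller-down : ∀ v → DownClosed (Taller v)
  taller-down v v<hj j'≤j = ℕP.<-≤-trans v<hj (height-anti j'≤j)

  opaque
    cover : ℕ → ℕ
    cover v = count (λ j → v <? height j)

    cover≤n : ∀ v → cover v ≤ n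
    cover≤n v = count≤ _

    cover-above : ∀ {v j} → v < height j → toℕ j < cover v
    cover-above {v} = count-above _ (taller-down v)

    cover-below : ∀ {v j} → toℕ j < cover v → v < height j
    cover-below {v} = count-below _ (taller-down v)

    cover-unique : ∀ v z → z ≤ n → (∀ j → toℕ j < z → v < height j) →
                   (∀ j → v < height j → toℕ j < z) → cover v ≡ z
    cover-unique v z bound all only = count-unique _ (taller-down v) z bound only all

  cover-anti : ∀ {v v'} → v ≤ v' → cover v' ≤ cover v
  cover-anti {v} {v'} v≤v' = ℕP.≮⇒≥ λ cv<cv' →
    let (j , j≡cv) = finAt (cover v) (ℕP.<-≤-trans cv<cv' (cover≤n v'))
    in  ℕP.<-irrefl j≡cv (cover-above (ℕP.≤-<-trans v≤v' (cover-below (subst (_< cover v') (sym j≡cv) cv<cv'))))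

  cover-height≤ : ∀ j → cover (height j) ≤ toℕ j
  cover-height≤ j = ℕP.≮⇒≥ λ j<c → ℕP.<-irrefl refl (cover-below j<c)

  height≤-of-cover : ∀ {j v} → cover v ≤ toℕ j → height j ≤ v
  height≤-of-cover {j} {v} c≤j = ℕP.≮⇒≥ λ v<hj → ℕP.<⇒≱ (cover-above v<hj) c≤j

  cover≤-of-height : ∀ {j v} → height j ≤ v → cover v ≤ toℕ j
  cover≤-of-height {j} {v} hj≤v = ℕP.≮⇒≥ λ j<c → ℕP.<⇒≱ (cover-below j<c) hj≤v

  cover-height<n : ∀ j → cover (height j) < n
  cover-height<n j = ℕP.≤-<-trans (cover-height≤ j) (FP.toℕ<n j)

  cover-n : cover n ≡ 0
  cover-n = cover-unique n 0 z≤n (λ _ ()) (λ j lt → contradiction (height≤n j) (ℕP.<⇒≱ lt))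

  cover>0 : ∀ (r : Fin n) → 0 < cover (toℕ r)
  cover>0 r = ℕP.≤-<-trans z≤n (cover-above {j = j₀}
                (subst (toℕ r <_) (sym (height-first j₀ j₀≡0)) (FP.toℕ<n r)))
    where
    j₀ : Fin n
    j₀ = proj₁ (finAt 0 (ℕP.≤-<-trans z≤n (FP.toℕ<n r)))
    j₀≡0 : toℕ j₀ ≡ 0
    j₀≡0 = proj₂ (finAt 0 (ℕP.≤-<-trans z≤n (FP.toℕ<n r)))

  height-at-cover : ∀ j j' → toℕ j' ≡ cover (height j) → height j' ≡ height j
  height-at-cover j j' j'≡c = ℕP.≤-antisym (height≤-of-cover (ℕP.≤-reflexive (sym j'≡c)))
    (height-anti (subst (_≤ toℕ j) (sym j'≡c) (cover-height≤ j)))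

  cover-drop : ∀ {v j} → height j ≡ suc v → cover (suc v) < cover v
  cover-drop {v} {j} hj≡ = ℕP.≤-<-trans (cover≤-of-height (ℕP.≤-reflexive hj≡))
                                        (cover-above (subst (v <_) (sym hj≡) ℕP.≤-refl))

  cover-<⇒> : ∀ {v v'} → cover v < cover v' → v' < v
  cover-<⇒> {v} {v'} lt = ℕP.≰⇒> λ v≤v' → ℕP.<⇒≱ lt (cover-anti v≤v')

  -- A column is "first" if no column to its left has the same height, i.e.
  -- it sits exactly at the cover of its height.

  First : Fin n → Set
  First j = cover (height j) ≡ toℕ j

  first-at-cover : ∀ j v → toℕ j ≡ cover v → First j
  first-at-cover j v j≡cv = trans (cover-unique (height j) (cover v) (cover≤n v) all only) (sym j≡cv)
    where
    hj≤v : height j ≤ v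
    hj≤v = height≤-of-cover (ℕP.≤-reflexive (sym j≡cv))
    all : ∀ j' → toℕ j' < cover v → height j < height j'
    all j' lt = ℕP.≤-<-trans hj≤v (cover-below lt)
    only : ∀ j' → height j < height j' → toℕ j' < cover v
    only j' lt = ℕP.≰⇒> λ cv≤j' → ℕP.<⇒≱ lt (height-anti (subst (_≤ toℕ j') (sym j≡cv) cv≤j'))

  first-zero : ∀ j → toℕ j ≡ 0 → First j
  first-zero j j≡0 = trans (ℕP.n≤0⇒n≡0 (subst (cover (height j) ≤_) j≡0 (cover-height≤ j))) (sym j≡0)

  first-step : ∀ {j j'} → toℕ j ≡ suc (toℕ j') → height j < height j' → First j
  first-step {j} {j'} j≡ lt = cover-unique (height j) (toℕ j) (ℕP.<⇒≤ (FP.toℕ<n j)) all only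
    where
    all : ∀ j'' → toℕ j'' < toℕ j → height j < height j''
    all j'' j''<j = ℕP.<-≤-trans lt (height-anti (ℕP.≤-pred (subst (toℕ j'' <_) j≡ j''<j)))
    only : ∀ j'' → height j < height j'' → toℕ j'' < toℕ j
    only j'' lt' = ℕP.≰⇒> λ j≤j'' → ℕP.<⇒≱ lt' (height-anti j≤j'')

  first-step⁻ : ∀ {j j'} → toℕ j ≡ suc (toℕ j') → First j → height j < height j'
  first-step⁻ {j} {j'} j≡ first = cover-below (subst (toℕ j' <_) (sym (trans first j≡)) ℕP.≤-refl)

  no-height : ∀ {r r'} → r' < r → ¬ cover r < cover r' → ∀ j → height j ≢ suc r'
  no-height {r} {r'} r'<r ¬grow j hj≡ =
    ¬grow (ℕP.≤-<-trans (cover≤-of-height (subst (_≤ r) (sym hj≡) r'<r))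
                        (cover-above (subst (r' <_) (sym hj≡) ℕP.≤-refl)))

module PsiLinear (n : ℕ) (A : Fin n → Fin n → ℚ) (dyck : IsDyck A) where

  open Prelims
  open LexMin using (module Greedy; lookup⇒∈; <ᵇ-true; <ᵇ-false)
  open Heights n A dyck
  open import Data.Nat as ℕ using (zero; suc; _∸_; _<_; _≤_; _<?_)
  import Data.Nat.Properties as ℕP
  open import Data.Nat.Induction using (<-rec)
  open import Data.Bool using (Bool; true; false; if_then_else_)
  open import Data.Fin as F using (toℕ)
  import Data.Fin.Properties as FP
  open import Data.Fin.Subset using (Subset; _∈_; ∣_∣)
  open import Data.Vec using (tabulate; _++_; lookup)
  import Data.Vec.Properties as VP
  open import Data.Rational using (0ℚ; 1ℚ; _*_; _+_; _-_; -_)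
  import Data.Rational.Properties as ℚP
  open import Data.Rational.Solver using (module +-*-Solver)
  open import Data.Product using (Σ; _×_; _,_; proj₁; proj₂)
  open import Data.Sum using (_⊎_; inj₁; inj₂; [_,_]′)
  open import Function using (_∘_; _⇔_)
  open import Level using (0ℓ)
  open import Relation.Nullary using (Dec; yes; no; does; ¬_; contradiction)
  open import Relation.Nullary.Decidable using (dec-true; dec-false; does-⇔)
  open import Relation.Unary using (Pred; Decidable)
  open import Relation.Binary.PropositionalEquality

  open +-*-Solver

  sign² : ∀ r → sign r * sign r ≡ 1ℚ
  sign² r = go (n ∸ suc (toℕ r))
    where
    neg² : ∀ q → (- q) * (- q) ≡ q * q
    neg² = solve 1 (λ q → (:- q) :* (:- q) := q :* q) refl
    go : ∀ m → negOnePow m * negOnePow m ≡ 1ℚ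
    go zero    = refl
    go (suc m) = trans (neg² (negOnePow m)) (go m)

  sign-cancel : ∀ r q → sign r * q ≡ 0ℚ → q ≡ 0ℚ
  sign-cancel r q e = begin
    q                    ≡⟨ sym (ℚP.*-identityˡ q) ⟩
    1ℚ * q               ≡⟨ cong (_* q) (sym (sign² r)) ⟩
    sign r * sign r * q  ≡⟨ ℚP.*-assoc (sign r) (sign r) q ⟩
    sign r * (sign r * q) ≡⟨ cong (sign r *_) e ⟩
    sign r * 0ℚ          ≡⟨ ℚP.*-zeroʳ (sign r) ⟩
    0ℚ                   ∎
    where open ≡-Reasoning

  sign≢0 : ∀ r → sign r ≢ 0ℚ
  sign≢0 r e = contradiction (trans (sym (sign² r)) (trans (cong (_* sign r) e) (ℚP.*-zeroˡ (sign r)))) λ ()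

  column-cases : ∀ c → (Σ (Fin n) λ r → c ≡ left r) ⊎ (Σ (Fin n) λ j → c ≡ right j)
  column-cases c with F.splitAt n c in eq
  ... | inj₁ r = inj₁ (r , sym (FP.splitAt⁻¹-↑ˡ eq))
  ... | inj₂ j = inj₂ (j , sym (FP.splitAt⁻¹-↑ʳ eq))

  toℕ-left : ∀ r → toℕ (left r) ≡ toℕ r
  toℕ-left r = FP.toℕ-↑ˡ r n

  toℕ-right : ∀ j → toℕ (right j) ≡ n ℕ.+ toℕ j
  toℕ-right j = FP.toℕ-↑ʳ n j

  left≢right : ∀ r j → left r ≢ right j
  left≢right r j e = ℕP.<⇒≢ (ℕP.<-≤-trans (FP.toℕ<n r) (ℕP.m≤m+n n (toℕ j)))
    (trans (sym (toℕ-left r)) (trans (cong toℕ e) (toℕ-right j)))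

  left-injective : ∀ {r r'} → left r ≡ left r' → r ≡ r'
  left-injective {r} {r'} = FP.↑ˡ-injective n r r'

  right-injective : ∀ {j j'} → right j ≡ right j' → j ≡ j'
  right-injective {j} {j'} = FP.↑ʳ-injective n j j'

  toℕ≢⇒left≢ : ∀ {r r' : Fin n} → toℕ r ≢ toℕ r' → left r ≢ left r'
  toℕ≢⇒left≢ r≢r' e = r≢r' (cong toℕ (left-injective e))

  toℕ≢⇒right≢ : ∀ {j j' : Fin n} → toℕ j ≢ toℕ j' → right j ≢ right j'
  toℕ≢⇒right≢ j≢j' e = j≢j' (cong toℕ (right-injective e))

  left≢⇒toℕ≢ : ∀ {r r' : Fin n} → left r ≢ left r' → toℕ r ≢ toℕ r'
  left≢⇒toℕ≢ ne e = ne (cong left (FP.toℕ-injective e))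

  right≢⇒toℕ≢ : ∀ {j j' : Fin n} → right j ≢ right j' → toℕ j ≢ toℕ j'
  right≢⇒toℕ≢ ne e = ne (cong right (FP.toℕ-injective e))

  opaque
    columns : {P Q : Pred (Fin n) 0ℓ} → Decidable P → Decidable Q → Subset (n ℕ.+ n)
    columns P? Q? = tabulate (does ∘ P?) ++ tabulate (does ∘ Q?)

    lookup-left : ∀ {P Q : Pred (Fin n) 0ℓ} (P? : Decidable P) (Q? : Decidable Q) r →
                  lookup (columns P? Q?) (left r) ≡ does (P? r)
    lookup-left P? Q? r = trans (VP.lookup-++ˡ (tabulate (does ∘ P?)) (tabulate (does ∘ Q?)) r)
                                (VP.lookup∘tabulate (does ∘ P?) r)

    lookup-right : ∀ {P Q : Pred (Fin n) 0ℓ} (P? : Decidable P) (Q? : Decidable Q) j →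
                   lookup (columns P? Q?) (right j) ≡ does (Q? j)
    lookup-right P? Q? j = trans (VP.lookup-++ʳ (tabulate (does ∘ P?)) (tabulate (does ∘ Q?)) j)
                                 (VP.lookup∘tabulate (does ∘ Q?) j)

    columns-cong : ∀ {P P' Q Q' : Pred (Fin n) 0ℓ}
      (P? : Decidable P) (P'? : Decidable P') (Q? : Decidable Q) (Q'? : Decidable Q') →
      (∀ r → P r ⇔ P' r) → (∀ j → Q j ⇔ Q' j) → columns P? Q? ≡ columns P'? Q'?
    columns-cong P? P'? Q? Q'? hp hq =
      cong₂ _++_ (VP.tabulate-cong (λ r → does-⇔ (hp r) (P? r) (P'? r)))
                 (VP.tabulate-cong (λ j → does-⇔ (hq j) (Q? j) (Q'? j)))

    ∣columns∣-identity : ∀ {P Q : Pred (Fin n) 0ℓ} (P? : Decidable P) (Q? : Decidable Q) →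
      (∀ r → P r) → (∀ j → ¬ Q j) → ∣ columns P? Q? ∣ ≡ n
    ∣columns∣-identity P? Q? all none =
      size (does ∘ P?) (does ∘ Q?) (λ r → dec-true (P? r) (all r)) (λ j → dec-false (Q? j) (none j))
      where
      size : ∀ {a b} (f : Fin a → Bool) (g : Fin b → Bool) →
             (∀ x → f x ≡ true) → (∀ x → g x ≡ false) → ∣ tabulate f ++ tabulate g ∣ ≡ a
      size {zero} {zero}  f g _ _ = refl
      size {zero} {suc b} f g _ none rewrite none F.zero = size f (g ∘ F.suc) (λ ()) (none ∘ F.suc)
      size {suc a}        f g all none rewrite all F.zero = cong suc (size (f ∘ F.suc) g (all ∘ F.suc) none)

  module _ {P Q : Pred (Fin n) 0ℓ} (P? : Decidable P) (Q? : Decidable Q) where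

    left∈⁺ : ∀ {r} → P r → left r ∈ columns P? Q?
    left∈⁺ {r} p = lookup⇒∈ (trans (lookup-left P? Q? r) (dec-true (P? r) p))

    left∈⁻ : ∀ {r} → left r ∈ columns P? Q? → P r
    left∈⁻ {r} l∈ = does-true (P? r) (trans (sym (lookup-left P? Q? r)) (VP.[]=⇒lookup l∈))

    right∈⁺ : ∀ {j} → Q j → right j ∈ columns P? Q?
    right∈⁺ {j} q = lookup⇒∈ (trans (lookup-right P? Q? j) (dec-true (Q? j) q))

    right∈⁻ : ∀ {j} → right j ∈ columns P? Q? → Q j
    right∈⁻ {j} r∈ = does-true (Q? j) (trans (sym (lookup-right P? Q? j)) (VP.[]=⇒lookup r∈))

  onPrefix : Fin n → Fin n → ℚ → ℚ
  onPrefix r j x = if toℕ r ℕ.<ᵇ height j then x else 0ℚ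

  onPrefix-below : ∀ {r j} x → toℕ r < height j → onPrefix r j x ≡ x
  onPrefix-below {r} {j} x lt rewrite <ᵇ-true lt = refl

  onPrefix-above : ∀ {r j} x → height j ≤ toℕ r → onPrefix r j x ≡ 0ℚ
  onPrefix-above {r} {j} x ge rewrite <ᵇ-false {toℕ r} {height j} ge = refl

  onPrefix-zero : ∀ r j → onPrefix r j 0ℚ ≡ 0ℚ
  onPrefix-zero r j with toℕ r ℕ.<ᵇ height j
  ... | true  = refl
  ... | false = refl

  covered : (Fin n → ℚ) → Fin n → ℚ
  covered μ r = sumFin (λ j → onPrefix r j (μ j))

  row-expansion : ∀ (λc : Fin (n ℕ.+ n) → ℚ) r →
    sumFin (λ c → λc c * B r c) ≡ λc (left r) + sign r * covered (λc ∘ right) r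
  row-expansion λc r = trans (sumFin-split n (λ c → λc c * B r c)) (cong₂ _+_ identity-part right-part)
    where
    identity-part : sumFin (λ r' → λc (left r') * B r (left r')) ≡ λc (left r)
    identity-part = trans (sumFin-single _ r other) (trans (cong (λc (left r) *_) (B-left-same r)) (ℚP.*-identityʳ _))
      where
      other : ∀ r' → r' ≢ r → λc (left r') * B r (left r') ≡ 0ℚ
      other r' r'≢r = trans (cong (λc (left r') *_) (B-left-other r r' (r'≢r ∘ sym))) (ℚP.*-zeroʳ (λc (left r')))
    right-part : sumFin (λ j → λc (right j) * B r (right j)) ≡ sign r * covered (λc ∘ right) r
    right-part = trans (sumFin-cong entry) (sumFin-scale (sign r) (λ j → onPrefix r j (λc (right j))))
      where
      entry : ∀ j → λc (right j) * B r (right j) ≡ sign r * onPrefix r j (λc (right j))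
      entry j with toℕ r <? height j
      ... | yes below = trans (cong (λc (right j) *_) (B-right-below below))
                        (trans (ℚP.*-comm (λc (right j)) (sign r)) (cong (sign r *_) (sym (onPrefix-below _ below))))
      ... | no  above = trans (cong (λc (right j) *_) (B-right-above (ℕP.≮⇒≥ above)))
                        (trans (ℚP.*-zeroʳ (λc (right j))) (trans (sym (ℚP.*-zeroʳ (sign r)))
                          (cong (sign r *_) (sym (onPrefix-above _ (ℕP.≮⇒≥ above))))))

  -- If every right column has a pivot, the set
  -- is independent: read at the pivot rows from left to right, the equations
  -- kill the right coefficients one by one, and then the identity coefficients.

  Pivot : (P Q : Pred (Fin n) 0ℓ) → Fin n → Set
  Pivot P Q j = Σ (Fin n) λ ρ → ¬ P ρ × toℕ ρ < height j ×
                  (∀ j' → Q j' → toℕ ρ < height j' → toℕ j' ≤ toℕ j)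

  independent : ∀ {P Q : Pred (Fin n) 0ℓ} (P? : Decidable P) (Q? : Decidable Q) →
                (∀ j → Q j → Pivot P Q j) → LinIndep B (columns P? Q?)
  independent {P} {Q} P? Q? pivot λc outside rows = vanish
    where
    row-equation : ∀ r → λc (left r) + sign r * covered (λc ∘ right) r ≡ 0ℚ
    row-equation r = trans (sym (row-expansion λc r)) (rows r)
    left-outside : ∀ r → ¬ P r → λc (left r) ≡ 0ℚ
    left-outside r ¬p = outside (left r) (¬p ∘ left∈⁻ P? Q?)
    right-outside : ∀ j → ¬ Q j → λc (right j) ≡ 0ℚ
    right-outside j ¬q = outside (right j) (¬q ∘ right∈⁻ P? Q?)

    RightZero : ℕ → Set
    RightZero x = ∀ j → toℕ j ≡ x → λc (right j) ≡ 0ℚ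

    right-zero : ∀ x → RightZero x
    right-zero = <-rec RightZero step
      where
      step : ∀ x → (∀ {y} → y < x → RightZero y) → RightZero x
      step x rec j refl with Q? j
      ... | no ¬q = right-outside j ¬q
      ... | yes q with pivot j q
      ...   | ρ , ¬pρ , ρ<hj , rightmost = trans (sym only-j) covered≡0
        where
        covered≡0 : covered (λc ∘ right) ρ ≡ 0ℚ
        covered≡0 = sign-cancel ρ (covered (λc ∘ right) ρ)
          (trans (sym (ℚP.+-identityˡ (sign ρ * covered (λc ∘ right) ρ)))
                 (trans (cong (_+ sign ρ * covered (λc ∘ right) ρ) (sym (left-outside ρ ¬pρ))) (row-equation ρ)))
        only-j : covered (λc ∘ right) ρ ≡ λc (right j)
        only-j = trans (sumFin-single (λ j' → onPrefix ρ j' (λc (right j'))) j other) (onPrefix-below _ ρ<hj)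
          where
          other : ∀ j' → j' ≢ j → onPrefix ρ j' (λc (right j')) ≡ 0ℚ
          other j' j'≢j with toℕ ρ <? height j'
          ... | no  ρ≮hj' = onPrefix-above _ (ℕP.≮⇒≥ ρ≮hj')
          ... | yes ρ<hj' with Q? j'
          ...   | no ¬q' = trans (cong (onPrefix ρ j') (right-outside j' ¬q')) (onPrefix-zero ρ j')
          ...   | yes q' = trans (cong (onPrefix ρ j') (rec j'<j j' refl)) (onPrefix-zero ρ j')
            where
            j'<j : toℕ j' < toℕ j
            j'<j = ℕP.≤∧≢⇒< (rightmost j' q' ρ<hj') (j'≢j ∘ FP.toℕ-injective)

    left-zero : ∀ r → λc (left r) ≡ 0ℚ
    left-zero r = trans (sym (ℚP.+-identityʳ (λc (left r))))
                        (trans (cong (λc (left r) +_) (sym sign·0)) (row-equation r))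
      where
      sign·0 : sign r * covered (λc ∘ right) r ≡ 0ℚ
      sign·0 = trans (cong (sign r *_) (sumFin-zero zero-term)) (ℚP.*-zeroʳ (sign r))
        where
        zero-term : ∀ j → onPrefix r j (λc (right j)) ≡ 0ℚ
        zero-term j = trans (cong (onPrefix r j) (right-zero (toℕ j) j refl)) (onPrefix-zero r j)

    vanish : ∀ c → λc c ≡ 0ℚ
    vanish c with column-cases c
    ... | inj₁ (r , refl) = left-zero r
    ... | inj₂ (j , refl) = right-zero (toℕ j) j refl

  -- For column indices a, b (an index ≥ n stands
  -- for the zero column), with  μ = e_a − e_b  on the right columns,
  --   Σ_j μ_j B_{right j} = Σ_r sign r · ([a < cover r] − [b < cover r]) B_{left r},
  -- because row r lies in the prefix of column a exactly when a < cover r.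

  unit : ℕ → Fin n → ℚ
  unit a j = if toℕ j ℕ.≡ᵇ a then 1ℚ else 0ℚ

  unit-hit : ∀ a j → toℕ j ≡ a → unit a j ≡ 1ℚ
  unit-hit a j j≡a with toℕ j ℕ.≡ᵇ a | ℕP.≡⇒≡ᵇ (toℕ j) a j≡a
  ... | true | _ = refl

  unit-miss : ∀ a j → toℕ j ≢ a → unit a j ≡ 0ℚ
  unit-miss a j j≢a with toℕ j ℕ.≡ᵇ a in eq
  ... | false = refl
  ... | true  = contradiction (ℕP.≡ᵇ⇒≡ (toℕ j) a (subst Data.Bool.T (sym eq) _)) j≢a

  inCover : ℕ → Fin n → ℚ
  inCover a r = if a ℕ.<ᵇ cover (toℕ r) then 1ℚ else 0ℚ

  covered-unit : ∀ a r → covered (unit a) r ≡ inCover a r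
  covered-unit a r with a <? n
  ... | no a≮n rewrite <ᵇ-false {a} {cover (toℕ r)} (ℕP.≤-trans (cover≤n (toℕ r)) (ℕP.≮⇒≥ a≮n)) =
    sumFin-zero λ j → trans (cong (onPrefix r j) (unit-miss a j λ j≡a → a≮n (subst (_< n) j≡a (FP.toℕ<n j))))
                            (onPrefix-zero r j)
  ... | yes a<n = trans (sumFin-single _ jₐ other) (onPrefix-unit (toℕ r <? height jₐ))
    where
    jₐ : Fin n
    jₐ = proj₁ (finAt a a<n)
    jₐ≡a : toℕ jₐ ≡ a
    jₐ≡a = proj₂ (finAt a a<n)
    other : ∀ j → j ≢ jₐ → onPrefix r j (unit a j) ≡ 0ℚ
    other j j≢jₐ = trans (cong (onPrefix r j) (unit-miss a j λ j≡a → j≢jₐ (FP.toℕ-injective (trans j≡a (sym jₐ≡a)))))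
                         (onPrefix-zero r j)
    onPrefix-unit : Dec (toℕ r < height jₐ) → onPrefix r jₐ (unit a jₐ) ≡ inCover a r
    onPrefix-unit (yes below) rewrite <ᵇ-true (subst (_< cover (toℕ r)) jₐ≡a (cover-above below)) =
      trans (onPrefix-below _ below) (unit-hit a jₐ jₐ≡a)
    onPrefix-unit (no above) rewrite <ᵇ-false {a} {cover (toℕ r)}
        (ℕP.≮⇒≥ λ a<c → above (cover-below (subst (_< cover (toℕ r)) (sym jₐ≡a) a<c))) =
      onPrefix-above _ (ℕP.≮⇒≥ above)

  relationCoeffs : ℕ → ℕ → Fin n → ℚ
  relationCoeffs a b j = unit a j - unit b j

  covered-relation : ∀ a b r → covered (relationCoeffs a b) r ≡ inCover a r - inCover b r
  covered-relation a b r =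
    trans (sumFin-cong (λ j → onPrefix-sub r j (unit a j) (unit b j)))
          (trans (sumFin-sub (λ j → onPrefix r j (unit a j)) (λ j → onPrefix r j (unit b j)))
                 (cong₂ _-_ (covered-unit a r) (covered-unit b r)))
    where
    onPrefix-sub : ∀ r j x y → onPrefix r j (x - y) ≡ onPrefix r j x - onPrefix r j y
    onPrefix-sub r j x y with toℕ r ℕ.<ᵇ height j
    ... | true  = refl
    ... | false = refl

  relation : ℕ → ℕ → Fin (n ℕ.+ n) → ℚ
  relation a b c = [ (λ r → - (sign r * covered (relationCoeffs a b) r)) , relationCoeffs a b ]′ (F.splitAt n c)

  relation-left′ : ∀ a b r → relation a b (left r) ≡ - (sign r * covered (relationCoeffs a b) r)
  relation-left′ a b r rewrite FP.splitAt-↑ˡ n r n = refl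

  relation-left : ∀ a b r → relation a b (left r) ≡ - (sign r * (inCover a r - inCover b r))
  relation-left a b r = trans (relation-left′ a b r) (cong (λ z → - (sign r * z)) (covered-relation a b r))

  relation-right : ∀ a b j → relation a b (right j) ≡ unit a j - unit b j
  relation-right a b j rewrite FP.splitAt-↑ʳ n n j = refl

  relation-kernel : ∀ a b r → sumFin (λ c → relation a b c * B r c) ≡ 0ℚ
  relation-kernel a b r = begin
    sumFin (λ c → relation a b c * B r c)                                   ≡⟨ row-expansion (relation a b) r ⟩
    relation a b (left r) + sign r * covered (relation a b ∘ right) r       ≡⟨ cong₂ _+_ (relation-left′ a b r)
                                                                                 (cong (sign r *_) right-part) ⟩
    - (sign r * covered (relationCoeffs a b) r) + sign r * covered (relationCoeffs a b) r
                                                                            ≡⟨ ℚP.+-inverseˡ (sign r * covered (relationCoeffs a b) r) ⟩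
    0ℚ                                                                      ∎
    where
    open ≡-Reasoning
    right-part : covered (relation a b ∘ right) r ≡ covered (relationCoeffs a b) r
    right-part = sumFin-cong λ j → cong (onPrefix r j) (relation-right a b j)

  inCover-yes : ∀ {a r} → a < cover (toℕ r) → inCover a r ≡ 1ℚ
  inCover-yes lt rewrite <ᵇ-true lt = refl

  inCover-no : ∀ {a r} → ¬ a < cover (toℕ r) → inCover a r ≡ 0ℚ
  inCover-no {a} {r} a≮c rewrite <ᵇ-false {a} {cover (toℕ r)} (ℕP.≮⇒≥ a≮c) = refl

  -- The support consists of the right columns
  -- a and b and the identity columns of the rows covered by exactly one of them.

  CoveredByOne : ℕ → ℕ → Fin n → Set
  CoveredByOne a b r = (a < cover (toℕ r) × ¬ b < cover (toℕ r)) ⊎ (¬ a < cover (toℕ r) × b < cover (toℕ r))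

  module Dependence (T : Subset (n ℕ.+ n)) (i x : Fin (n ℕ.+ n)) (a b : ℕ) where
    open Greedy B i using (rankOf; EarlierDependence)

    dependence :
      ((Σ (Fin n) λ j → x ≡ right j × toℕ j ≡ a × b ≢ a) ⊎
       (Σ (Fin n) λ r → x ≡ left r × a < cover (toℕ r) × ¬ b < cover (toℕ r))) →
      (∀ j → (toℕ j ≡ a ⊎ toℕ j ≡ b) → right j ≢ x → right j ∈ T × rankOf (right j) < rankOf x) →
      (∀ r → CoveredByOne a b r → left r ≢ x → left r ∈ T × rankOf (left r) < rankOf x) →
      EarlierDependence T x
    dependence x-in-support right-support left-support =
      relation a b , x-coeff x-in-support , support , relation-kernel a b
      where
      1-0≢0 : 1ℚ - 0ℚ ≢ 0ℚ
      1-0≢0 ()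
      x-coeff : _ → relation a b x ≢ 0ℚ
      x-coeff (inj₁ (j , refl , j≡a , b≢a)) z = 1-0≢0 (begin
        1ℚ - 0ℚ                ≡⟨ cong₂ _-_ (sym (unit-hit a j j≡a))
                                            (sym (unit-miss b j λ j≡b → b≢a (trans (sym j≡b) j≡a))) ⟩
        unit a j - unit b j    ≡⟨ sym (relation-right a b j) ⟩
        relation a b (right j) ≡⟨ z ⟩
        0ℚ                     ∎)
        where open ≡-Reasoning
      x-coeff (inj₂ (r , refl , a<c , b≮c)) z = sign≢0 r (begin
        sign r                         ≡⟨ sym (ℚP.*-identityʳ (sign r)) ⟩
        sign r * (1ℚ - 0ℚ)             ≡⟨ cong (sign r *_) (sym (cong₂ _-_ (inCover-yes a<c) (inCover-no b≮c))) ⟩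
        sign r * (inCover a r - inCover b r) ≡⟨ ℚP.neg-injective (trans (sym (relation-left a b r)) z) ⟩
        0ℚ                             ∎)
        where open ≡-Reasoning
      support : ∀ c → relation a b c ≢ 0ℚ → c ≢ x → c ∈ T × rankOf c < rankOf x
      support c nz c≢x with column-cases c
      ... | inj₂ (j , refl) = right-support j a-or-b c≢x
        where
        a-or-b : toℕ j ≡ a ⊎ toℕ j ≡ b
        a-or-b with toℕ j ℕ.≟ a | toℕ j ℕ.≟ b
        ... | yes j≡a | _       = inj₁ j≡a
        ... | no  _   | yes j≡b = inj₂ j≡b
        ... | no j≢a  | no j≢b  = contradiction (trans (relation-right a b j)
                                    (cong₂ _-_ (unit-miss a j j≢a) (unit-miss b j j≢b))) nz
      ... | inj₁ (r , refl) = left-support r exactly-one c≢x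
        where
        zero-if-same : ∀ {u} → inCover a r ≡ u → inCover b r ≡ u → relation a b (left r) ≡ 0ℚ
        zero-if-same {u} ea eb = trans (relation-left a b r)
          (trans (cong (λ v → - (sign r * v)) (trans (cong₂ _-_ ea eb) (ℚP.+-inverseʳ u)))
                 (cong -_ (ℚP.*-zeroʳ (sign r))))
        exactly-one : CoveredByOne a b r
        exactly-one with a <? cover (toℕ r) | b <? cover (toℕ r)
        ... | yes a<c | no b≮c  = inj₁ (a<c , b≮c)
        ... | no a≮c  | yes b<c = inj₂ (a≮c , b<c)
        ... | yes a<c | yes b<c = contradiction (zero-if-same (inCover-yes a<c) (inCover-yes b<c)) nz
        ... | no a≮c  | no b≮c  = contradiction (zero-if-same (inCover-no a≮c) (inCover-no b≮c)) nz

module Necklace (n : ℕ) (A : Fin n → Fin n → ℚ) (dyck : IsDyck A) where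

  open Prelims
  open Heights n A dyck
  open PsiLinear n A dyck
  open import Data.Nat as ℕ using (suc; _<_; _≤_; _<?_; _≤?_)
  import Data.Nat.Properties as ℕP
  open import Data.Fin using (toℕ)
  import Data.Fin.Properties as FP
  open import Data.Fin.Subset using (Subset)
  open import Data.Product using (Σ; _×_; _,_)
  open import Data.Sum using (_⊎_; inj₁; inj₂)
  open import Relation.Nullary using (Dec; yes; no; ¬_; ¬?; contradiction)
  open import Relation.Nullary.Decidable using (_×-dec_; _⊎-dec_; _→-dec_; decidable-stable)
  open import Function using (_∘′_)
  open import Relation.Binary.PropositionalEquality

  RowAtLeft : ℕ → Fin n → Set
  RowAtLeft i r = i ≤ toℕ r ⊎ (suc (toℕ r) < i × (∀ j → height j ≢ suc (toℕ r)))

  ColAtLeft : ℕ → Fin n → Set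
  ColAtLeft i j = 0 < i × First j × (height j < i ⊎ height j ≡ n)

  RowAtRight : ℕ → Fin n → Set
  RowAtRight j₀ r = ∀ j → j₀ ≤ toℕ j → height j ≢ suc (toℕ r)

  ColAtRight : ℕ → Fin n → Set
  ColAtRight j₀ j = j₀ ≤ toℕ j × (toℕ j ≡ j₀ ⊎ First j)

  no-height? : ∀ v → Dec (∀ j → height j ≢ v)
  no-height? v = FP.all? (λ j → ¬? (height j ℕ.≟ v))

  first? : ∀ j → Dec (First j)
  first? j = cover (height j) ℕ.≟ toℕ j

  rowAtLeft? : ∀ i r → Dec (RowAtLeft i r)
  rowAtLeft? i r = (i ≤? toℕ r) ⊎-dec ((suc (toℕ r) <? i) ×-dec no-height? (suc (toℕ r)))

  colAtLeft? : ∀ i j → Dec (ColAtLeft i j)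
  colAtLeft? i j = (0 <? i) ×-dec first? j ×-dec ((height j <? i) ⊎-dec (height j ℕ.≟ n))

  rowAtRight? : ∀ j₀ r → Dec (RowAtRight j₀ r)
  rowAtRight? j₀ r = FP.all? (λ j → (j₀ ≤? toℕ j) →-dec ¬? (height j ℕ.≟ suc (toℕ r)))

  colAtRight? : ∀ j₀ j → Dec (ColAtRight j₀ j)
  colAtRight? j₀ j = (j₀ ≤? toℕ j) ×-dec ((toℕ j ℕ.≟ j₀) ⊎-dec first? j)

  leftSet : ℕ → Subset (n ℕ.+ n)
  leftSet i = columns (rowAtLeft? i) (colAtLeft? i)

  rightSet : ℕ → Subset (n ℕ.+ n)
  rightSet j₀ = columns (rowAtRight? j₀) (colAtRight? j₀)

  some-height : ∀ v → ¬ (∀ j → height j ≢ v) → Σ (Fin n) λ j → height j ≡ v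
  some-height v ¬none with FP.¬∀⟶∃¬ n _ (λ j → ¬? (height j ℕ.≟ v)) ¬none
  ... | j , ¬≢ = j , decidable-stable (height j ℕ.≟ v) ¬≢

  ¬rowAtLeft : ∀ {i r} → ¬ RowAtLeft i r →
               toℕ r < i × (i ≤ suc (toℕ r) ⊎ Σ (Fin n) λ j → height j ≡ suc (toℕ r))
  ¬rowAtLeft {i} {r} ¬row = ℕP.≰⇒> (¬row ∘′ inj₁) , second
    where
    second : i ≤ suc (toℕ r) ⊎ Σ (Fin n) λ j → height j ≡ suc (toℕ r)
    second with suc (toℕ r) <? i
    ... | no  r+1≮i = inj₁ (ℕP.≮⇒≥ r+1≮i)
    ... | yes r+1<i = inj₂ (some-height _ λ none → ¬row (inj₂ (r+1<i , none)))

  ¬rowAtRight : ∀ {j₀ r} → ¬ RowAtRight j₀ r → Σ (Fin n) λ j → j₀ ≤ toℕ j × height j ≡ suc (toℕ r)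
  ¬rowAtRight {j₀} {r} ¬row with FP.¬∀⟶∃¬ n _ (λ j → (j₀ ≤? toℕ j) →-dec ¬? (height j ℕ.≟ suc (toℕ r)))
                                            ¬row
  ... | j , ¬imp with j₀ ≤? toℕ j
  ...   | no  j₀≰j = contradiction (λ j₀≤j → contradiction j₀≤j j₀≰j) ¬imp
  ...   | yes j₀≤j = j , j₀≤j , decidable-stable (height j ℕ.≟ suc (toℕ r)) (λ ne → ¬imp (λ _ → ne))

  ¬colAtRight : ∀ {j₀ j} → ¬ ColAtRight j₀ j → toℕ j < j₀ ⊎ (j₀ < toℕ j × ¬ First j)
  ¬colAtRight {j₀} {j} ¬col with toℕ j <? j₀
  ... | yes j<j₀ = inj₁ j<j₀
  ... | no  j≮j₀ = inj₂ (ℕP.≤∧≢⇒< (ℕP.≮⇒≥ j≮j₀) (λ j₀≡j → ¬col (ℕP.≮⇒≥ j≮j₀ , inj₁ (sym j₀≡j))) ,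
                         λ first → ¬col (ℕP.≮⇒≥ j≮j₀ , inj₂ first))

module Bases (n : ℕ) (A : Fin n → Fin n → ℚ) (dyck : IsDyck A) where

  open Prelims
  open LexMin
  open Heights n A dyck
  open PsiLinear n A dyck
  open Necklace n A dyck
  open import Data.Nat as ℕ using (suc; _<_; _≤_; _<?_; _≤?_; z≤n; s≤s; _⊔_)
  import Data.Nat.Properties as ℕP
  open import Data.Fin using (toℕ)
  import Data.Fin.Properties as FP
  open import Data.Fin.Subset using (Subset; _∈_; _∉_)
  open import Data.Product using (Σ; _×_; _,_; proj₁; proj₂)
  open import Data.Sum using (_⊎_; inj₁; inj₂)
  open import Data.Empty using (⊥)
  open import Relation.Nullary using (yes; no; ¬_; contradiction)
  open import Relation.Binary.PropositionalEquality

  -- Each set of Necklace is independent (every right column has a pivot row)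
  -- and every column outside it is an earlier dependence (a relation of
  -- PsiLinear supported on it and earlier columns of the set).  By the greedy
  -- criterion it is therefore the lex-minimal basis for its start column.

  right<left : ∀ (j r : Fin n) → n ℕ.+ toℕ j < (n ℕ.+ n) ℕ.+ toℕ r
  right<left j r = ℕP.<-≤-trans (ℕP.+-monoʳ-< n (FP.toℕ<n j)) (ℕP.m≤m+n (n ℕ.+ n) (toℕ r))

  module AtLeft (i₀ : Fin n) where
    i : ℕ
    i = toℕ i₀
    T : Subset (n ℕ.+ n)
    T = leftSet i
    open Greedy B (left i₀) using (rankOf; EarlierDependence)
    open Dependence T (left i₀)

    place : Fin (n ℕ.+ n) → ℕ
    place c = unrolled (n ℕ.+ n) (toℕ (left i₀)) (toℕ c)

    earlier : ∀ {c x} → place c < place x → rankOf c < rankOf x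
    earlier {c} {x} = rank-< (n ℕ.+ n) (toℕ (left i₀)) (toℕ c) (toℕ x) (ℕP.<⇒≤ (FP.toℕ<n (left i₀)))

    place-left-after : ∀ r → i ≤ toℕ r → place (left r) ≡ toℕ r
    place-left-after r i≤r rewrite toℕ-left r | toℕ-left i₀ = unrolled-after (n ℕ.+ n) i (toℕ r) i≤r

    place-left-before : ∀ r → toℕ r < i → place (left r) ≡ (n ℕ.+ n) ℕ.+ toℕ r
    place-left-before r r<i rewrite toℕ-left r | toℕ-left i₀ = unrolled-before (n ℕ.+ n) i (toℕ r) r<i

    place-right : ∀ j → place (right j) ≡ n ℕ.+ toℕ j
    place-right j rewrite toℕ-right j | toℕ-left i₀ =
      unrolled-after (n ℕ.+ n) i (n ℕ.+ toℕ j) (ℕP.≤-trans (ℕP.<⇒≤ (FP.toℕ<n i₀)) (ℕP.m≤m+n n (toℕ j)))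

    inRow : ∀ {r} → RowAtLeft i r → left r ∈ T
    inRow = left∈⁺ (rowAtLeft? i) (colAtLeft? i)

    inCol : ∀ {j} → ColAtLeft i j → right j ∈ T
    inCol = right∈⁺ (rowAtLeft? i) (colAtLeft? i)

    -- Pivots: the first column (height n) uses row i - 1; a column of height
    -- h < i uses row h - 1.
    independentAtLeft : LinIndep B T
    independentAtLeft = independent (rowAtLeft? i) (colAtLeft? i) pivot
      where
      first-bound : ∀ {j' ρ} → First j' → toℕ ρ < height j' → toℕ j' ≤ cover (suc (toℕ ρ))
      first-bound first' ρ<h = subst (_≤ _) first' (cover-anti ρ<h)

      pivot : ∀ j → ColAtLeft i j → Pivot (RowAtLeft i) (ColAtLeft i) j
      pivot j (0<i , first , inj₂ hj≡n) = ρ , outside , ρ<hj , rightmost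
        where
        ρ : Fin n
        ρ = proj₁ (prevRow 0<i (ℕP.<⇒≤ (FP.toℕ<n i₀)))
        ρ+1≡i : suc (toℕ ρ) ≡ i
        ρ+1≡i = proj₂ (prevRow 0<i (ℕP.<⇒≤ (FP.toℕ<n i₀)))
        outside : ¬ RowAtLeft i ρ
        outside (inj₁ i≤ρ)       = ℕP.<-irrefl refl (subst (_≤ toℕ ρ) (sym ρ+1≡i) i≤ρ)
        outside (inj₂ (ρ+1<i , _)) = ℕP.<-irrefl ρ+1≡i ρ+1<i
        ρ<hj : toℕ ρ < height j
        ρ<hj = subst (toℕ ρ <_) (sym hj≡n) (FP.toℕ<n ρ)
        rightmost : ∀ j' → ColAtLeft i j' → toℕ ρ < height j' → toℕ j' ≤ toℕ j
        rightmost j' (_ , _ , inj₁ hj'<i) ρ<hj' =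
          contradiction (subst (_≤ height j') ρ+1≡i ρ<hj') (ℕP.<⇒≱ hj'<i)
        rightmost j' (_ , first' , inj₂ hj'≡n) _ =
          subst (_≤ toℕ j) (trans (sym (cong cover hj'≡n) ) first') (subst (_≤ toℕ j) (sym cover-n) z≤n)
      pivot j (0<i , first , inj₁ hj<i) = ρ , outside , ρ<hj , rightmost
        where
        ρ : Fin n
        ρ = proj₁ (topRow j)
        ρ+1≡hj : suc (toℕ ρ) ≡ height j
        ρ+1≡hj = proj₂ (topRow j)
        ρ<hj : toℕ ρ < height j
        ρ<hj = subst (toℕ ρ <_) ρ+1≡hj ℕP.≤-refl
        outside : ¬ RowAtLeft i ρ
        outside (inj₁ i≤ρ)          = ℕP.<⇒≱ (ℕP.<-trans ρ<hj hj<i) i≤ρ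
        outside (inj₂ (_ , no-hgt)) = no-hgt j (sym ρ+1≡hj)
        rightmost : ∀ j' → ColAtLeft i j' → toℕ ρ < height j' → toℕ j' ≤ toℕ j
        rightmost j' (_ , first' , _) ρ<hj' =
          subst (toℕ j' ≤_) (trans (cong cover ρ+1≡hj) first) (first-bound first' ρ<hj')

    -- Order facts: the columns come in the order  left i … left (n-1),
    -- right 0 … right (n-1),  left 0 … left (i-1).
    left-before-left : ∀ {r r'} → toℕ r' < toℕ r → toℕ r < i → rankOf (left r') < rankOf (left r)
    left-before-left {r} {r'} r'<r r<i = earlier (subst₂ _<_ (sym (place-left-before r' (ℕP.<-trans r'<r r<i)))
                                                     (sym (place-left-before r r<i)) (ℕP.+-monoʳ-< (n ℕ.+ n) r'<r))

    after-before-left : ∀ {r r'} → i ≤ toℕ r' → toℕ r < i → rankOf (left r') < rankOf (left r)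
    after-before-left {r} {r'} i≤r' r<i =
      earlier (subst₂ _<_ (sym (place-left-after r' i≤r')) (sym (place-left-before r r<i))
      (ℕP.<-≤-trans (ℕP.<-≤-trans (FP.toℕ<n r') (ℕP.m≤m+n n n)) (ℕP.m≤m+n (n ℕ.+ n) (toℕ r))))

    right-before-left : ∀ j {r} → toℕ r < i → rankOf (right j) < rankOf (left r)
    right-before-left j {r} r<i =
      earlier (subst₂ _<_ (sym (place-right j)) (sym (place-left-before r r<i)) (right<left j r))

    right-before-right : ∀ {j' j} → toℕ j' < toℕ j → rankOf (right j') < rankOf (right j)
    right-before-right {j'} {j} j'<j =
      earlier (subst₂ _<_ (sym (place-right j')) (sym (place-right j)) (ℕP.+-monoʳ-< n j'<j))

    after-before-right : ∀ {r'} j → i ≤ toℕ r' → rankOf (left r') < rankOf (right j)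
    after-before-right {r'} j i≤r' = earlier (subst₂ _<_ (sym (place-left-after r' i≤r')) (sym (place-right j))
                                              (ℕP.<-≤-trans (FP.toℕ<n r') (ℕP.m≤m+n n (toℕ j))))

    first-in : ∀ j v → toℕ j ≡ cover v → v < i → right j ∈ T
    first-in j v j≡c v<i = inCol (ℕP.≤-<-trans z≤n v<i , first-at-cover j v j≡c ,
                                  inj₁ (ℕP.≤-<-trans (height≤-of-cover (ℕP.≤-reflexive (sym j≡c))) v<i))

    -- left (i - 1) is the relation between column 0 and the first column of
    -- height ≤ i - 1
    dependent-last-row : ∀ r → toℕ r < i → i ≤ suc (toℕ r) → EarlierDependence T (left r)
    dependent-last-row r r<i i≤r+1 =
      dependence (left r) 0 (cover (toℕ r)) (inj₂ (r , refl , cover>0 r , ℕP.<-irrefl refl)) rs ls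
      where
      rs : ∀ j → (toℕ j ≡ 0 ⊎ toℕ j ≡ cover (toℕ r)) → right j ≢ left r →
           right j ∈ T × rankOf (right j) < rankOf (left r)
      rs j (inj₁ j≡0) _ = inCol (ℕP.≤-<-trans z≤n r<i , first-zero j j≡0 , inj₂ (height-first j j≡0)) ,
                          right-before-left j r<i
      rs j (inj₂ j≡c) _ = first-in j (toℕ r) j≡c r<i , right-before-left j r<i
      ls : ∀ r' → CoveredByOne 0 (cover (toℕ r)) r' → left r' ≢ left r →
           left r' ∈ T × rankOf (left r') < rankOf (left r)
      ls r' (inj₂ (¬0<c , _)) _ = contradiction (cover>0 r') ¬0<c
      ls r' (inj₁ (_ , ¬grow)) r'≢r with i ≤? toℕ r'
      ... | yes i≤r' = inRow (inj₁ i≤r') , after-before-left i≤r' r<i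
      ... | no  i≰r' = inRow (inj₂ (ℕP.≤-<-trans r'<r r<i , no-height r'<r ¬grow)) , left-before-left r'<r r<i
        where
        r'<r : toℕ r' < toℕ r
        r'<r = ℕP.≤∧≢⇒< (ℕP.≤-pred (ℕP.<-≤-trans (ℕP.≰⇒> i≰r') i≤r+1)) (left≢⇒toℕ≢ r'≢r)

    -- left r with r + 1 < i a height is the relation between the first columns
    -- of heights ≤ r + 1 and ≤ r
    dependent-low-row : ∀ r j₁ → suc (toℕ r) < i → height j₁ ≡ suc (toℕ r) → EarlierDependence T (left r)
    dependent-low-row r j₁ r+1<i hj₁≡ =
      dependence (left r) (cover (suc (toℕ r))) (cover (toℕ r)) (inj₂ (r , refl , drop , ℕP.<-irrefl refl)) rs ls
      where
      r<i : toℕ r < i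
      r<i = ℕP.<-trans ℕP.≤-refl r+1<i
      drop : cover (suc (toℕ r)) < cover (toℕ r)
      drop = cover-drop hj₁≡
      rs : ∀ j → (toℕ j ≡ cover (suc (toℕ r)) ⊎ toℕ j ≡ cover (toℕ r)) → right j ≢ left r →
           right j ∈ T × rankOf (right j) < rankOf (left r)
      rs j (inj₁ j≡c) _ = first-in j (suc (toℕ r)) j≡c r+1<i , right-before-left j r<i
      rs j (inj₂ j≡c) _ = first-in j (toℕ r) j≡c r<i , right-before-left j r<i
      ls : ∀ r' → CoveredByOne (cover (suc (toℕ r))) (cover (toℕ r)) r' → left r' ≢ left r →
           left r' ∈ T × rankOf (left r') < rankOf (left r)
      ls r' (inj₂ (¬a<c , b<c)) _ = contradiction (ℕP.<-trans drop b<c) ¬a<c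
      ls r' (inj₁ (a<c , ¬grow)) r'≢r =
        inRow (inj₂ (ℕP.<-trans (s≤s r'<r) r+1<i , no-height r'<r ¬grow)) , left-before-left r'<r r<i
        where
        r'<r : toℕ r' < toℕ r
        r'<r = ℕP.≤∧≢⇒< (ℕP.≤-pred (cover-<⇒> a<c)) (left≢⇒toℕ≢ r'≢r)

    -- for i = 0, T consists of the identity columns
    dependent-right-start : ∀ j → i ≡ 0 → EarlierDependence T (right j)
    dependent-right-start j i≡0 =
      dependence (right j) (toℕ j) n (inj₁ (j , refl , refl , λ n≡j → ℕP.<-irrefl (sym n≡j) (FP.toℕ<n j))) rs ls
      where
      rs : ∀ j' → (toℕ j' ≡ toℕ j ⊎ toℕ j' ≡ n) → right j' ≢ right j →
           right j' ∈ T × rankOf (right j') < rankOf (right j)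
      rs j' (inj₁ e) j'≢j = contradiction e (right≢⇒toℕ≢ j'≢j)
      rs j' (inj₂ e) _    = contradiction e (ℕP.<⇒≢ (FP.toℕ<n j'))
      ls : ∀ r' → CoveredByOne (toℕ j) n r' → left r' ≢ right j →
           left r' ∈ T × rankOf (left r') < rankOf (right j)
      ls r' (inj₂ (_ , n<c)) _ = contradiction (cover≤n (toℕ r')) (ℕP.<⇒≱ n<c)
      ls r' (inj₁ _) _ = inRow (inj₁ i≤r') , after-before-right j i≤r'
        where
        i≤r' : i ≤ toℕ r'
        i≤r' = subst (_≤ toℕ r') (sym i≡0) z≤n

    -- a column j of height < i that is not first equals the first column of
    -- its height
    dependent-right-short : ∀ j → 0 < i → height j < i → ¬ First j → EarlierDependence T (right j)
    dependent-right-short j 0<i hj<i ¬first =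
      dependence (right j) (toℕ j) (toℕ j₁) (inj₁ (j , refl , refl , λ j₁≡j → ¬first (trans (sym j₁≡c) j₁≡j)))
                 rs ls
      where
      j₁ : Fin n
      j₁ = proj₁ (finAt (cover (height j)) (cover-height<n j))
      j₁≡c : toℕ j₁ ≡ cover (height j)
      j₁≡c = proj₂ (finAt (cover (height j)) (cover-height<n j))
      hj₁≡hj : height j₁ ≡ height j
      hj₁≡hj = height-at-cover j j₁ j₁≡c
      rs : ∀ j' → (toℕ j' ≡ toℕ j ⊎ toℕ j' ≡ toℕ j₁) → right j' ≢ right j →
           right j' ∈ T × rankOf (right j') < rankOf (right j)
      rs j' (inj₁ e) j'≢j = contradiction e (right≢⇒toℕ≢ j'≢j)
      rs j' (inj₂ e) _    = first-in j' (height j) (trans e j₁≡c) hj<i ,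
                            right-before-right (subst (_< toℕ j) (sym (trans e j₁≡c)) (ℕP.≤∧≢⇒< (cover-height≤ j) ¬first))
      -- j and j₁ have the same height, hence cover the same rows
      ls : ∀ r' → CoveredByOne (toℕ j) (toℕ j₁) r' → left r' ≢ right j →
           left r' ∈ T × rankOf (left r') < rankOf (right j)
      ls r' (inj₁ (j<c , ¬j₁<c)) _ =
        contradiction (cover-above (subst (toℕ r' <_) (sym hj₁≡hj) (cover-below j<c))) ¬j₁<c
      ls r' (inj₂ (¬j<c , j₁<c)) _ =
        contradiction (cover-above (subst (toℕ r' <_) hj₁≡hj (cover-below j₁<c))) ¬j<c

    -- a column j ≠ 0 of height ≥ i is related to column 0
    dependent-right-tall : ∀ j → 0 < i → i ≤ height j → toℕ j ≢ 0 → EarlierDependence T (right j)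
    dependent-right-tall j 0<i i≤hj j≢0 =
      dependence (right j) (toℕ j) 0 (inj₁ (j , refl , refl , λ 0≡j → j≢0 (sym 0≡j))) rs ls
      where
      rs : ∀ j' → (toℕ j' ≡ toℕ j ⊎ toℕ j' ≡ 0) → right j' ≢ right j →
           right j' ∈ T × rankOf (right j') < rankOf (right j)
      rs j' (inj₁ e) j'≢j = contradiction e (right≢⇒toℕ≢ j'≢j)
      rs j' (inj₂ e) _    = inCol (0<i , first-zero j' e , inj₂ (height-first j' e)) ,
                            right-before-right (subst (_< toℕ j) (sym e) (ℕP.n≢0⇒n>0 j≢0))
      ls : ∀ r' → CoveredByOne (toℕ j) 0 r' → left r' ≢ right j →
           left r' ∈ T × rankOf (left r') < rankOf (right j)
      ls r' (inj₁ (_ , ¬0<c)) _ = contradiction (cover>0 r') ¬0<c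
      ls r' (inj₂ (¬j<c , _)) _ = inRow (inj₁ i≤r') , after-before-right j i≤r'
        where
        i≤r' : i ≤ toℕ r'
        i≤r' = ℕP.≤-trans i≤hj (ℕP.≮⇒≥ λ r'<hj → ¬j<c (cover-above r'<hj))

    dependentAtLeft : ∀ x → x ∉ T → EarlierDependence T x
    dependentAtLeft x x∉T with column-cases x
    ... | inj₁ (r , refl) = left-case (¬rowAtLeft (λ row → x∉T (inRow row)))
      where
      left-case : toℕ r < i × (i ≤ suc (toℕ r) ⊎ Σ (Fin n) λ j → height j ≡ suc (toℕ r)) →
                  EarlierDependence T (left r)
      left-case (r<i , inj₁ i≤r+1) = dependent-last-row r r<i i≤r+1
      left-case (r<i , inj₂ (j₁ , hj₁≡)) with i ≤? suc (toℕ r)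
      ... | yes i≤r+1 = dependent-last-row r r<i i≤r+1
      ... | no  i≰r+1 = dependent-low-row r j₁ (ℕP.≰⇒> i≰r+1) hj₁≡
    ... | inj₂ (j , refl) = right-case (λ col → x∉T (inCol col))
      where
      right-case : ¬ ColAtLeft i j → EarlierDependence T (right j)
      right-case ¬col with i ℕ.≟ 0 | height j <? i
      ... | yes i≡0 | _        = dependent-right-start j i≡0
      ... | no  i≢0 | yes hj<i = dependent-right-short j (ℕP.n≢0⇒n>0 i≢0) hj<i
                                   (λ first → ¬col (ℕP.n≢0⇒n>0 i≢0 , first , inj₁ hj<i))
      ... | no  i≢0 | no  hj≮i = dependent-right-tall j (ℕP.n≢0⇒n>0 i≢0) (ℕP.≮⇒≥ hj≮i)
                                   (λ j≡0 → ¬col (ℕP.n≢0⇒n>0 i≢0 , first-zero j j≡0 , inj₂ (height-first j j≡0)))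

  module AtRight (j₀ : Fin n) where
    k : ℕ
    k = toℕ j₀
    T : Subset (n ℕ.+ n)
    T = rightSet k
    open Greedy B (right j₀) using (rankOf; EarlierDependence)
    open Dependence T (right j₀)

    place : Fin (n ℕ.+ n) → ℕ
    place c = unrolled (n ℕ.+ n) (toℕ (right j₀)) (toℕ c)

    earlier : ∀ {c x} → place c < place x → rankOf c < rankOf x
    earlier {c} {x} = rank-< (n ℕ.+ n) (toℕ (right j₀)) (toℕ c) (toℕ x) (ℕP.<⇒≤ (FP.toℕ<n (right j₀)))

    place-left : ∀ r → place (left r) ≡ (n ℕ.+ n) ℕ.+ toℕ r
    place-left r rewrite toℕ-left r | toℕ-right j₀ =
      unrolled-before (n ℕ.+ n) (n ℕ.+ k) (toℕ r) (ℕP.<-≤-trans (FP.toℕ<n r) (ℕP.m≤m+n n k))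

    place-right-after : ∀ j → k ≤ toℕ j → place (right j) ≡ n ℕ.+ toℕ j
    place-right-after j k≤j rewrite toℕ-right j | toℕ-right j₀ =
      unrolled-after (n ℕ.+ n) (n ℕ.+ k) (n ℕ.+ toℕ j) (ℕP.+-monoʳ-≤ n k≤j)

    place-right-before : ∀ j → toℕ j < k → place (right j) ≡ (n ℕ.+ n) ℕ.+ (n ℕ.+ toℕ j)
    place-right-before j j<k rewrite toℕ-right j | toℕ-right j₀ =
      unrolled-before (n ℕ.+ n) (n ℕ.+ k) (n ℕ.+ toℕ j) (ℕP.+-monoʳ-< n j<k)

    inRow : ∀ {r} → RowAtRight k r → left r ∈ T
    inRow = left∈⁺ (rowAtRight? k) (colAtRight? k)

    inCol : ∀ {j} → ColAtRight k j → right j ∈ T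
    inCol = right∈⁺ (rowAtRight? k) (colAtRight? k)

    -- the column  k ⊔ cover v  is in T: it is j₀ itself or a first column
    max-in : ∀ j v → toℕ j ≡ k ⊔ cover v → ColAtRight k j
    max-in j v j≡ with cover v ℕ.≤? k
    ... | yes c≤k = subst (k ≤_) (sym j≡) (ℕP.m≤m⊔n k _) , inj₁ (trans j≡ (ℕP.m≥n⇒m⊔n≡m c≤k))
    ... | no  c≰k = subst (k ≤_) (sym j≡) (ℕP.m≤m⊔n k _) ,
                    inj₂ (first-at-cover j v (trans j≡ (ℕP.m≤n⇒m⊔n≡n (ℕP.<⇒≤ (ℕP.≰⇒> c≰k)))))

    below-max : ∀ {j' : Fin n} {v} → toℕ j' < k ⊔ cover v → k ≤ toℕ j' → toℕ j' < cover v
    below-max {j'} lt k≤j' = ℕP.≰⇒> λ c≤j' → ℕP.<⇒≱ lt (ℕP.⊔-lub k≤j' c≤j')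

    -- Every column j of T uses the last row of its prefix as pivot.
    independentAtRight : LinIndep B T
    independentAtRight = independent (rowAtRight? k) (colAtRight? k) pivot
      where
      pivot : ∀ j → ColAtRight k j → Pivot (RowAtRight k) (ColAtRight k) j
      pivot j (k≤j , _) = ρ , (λ row → row j k≤j (sym ρ+1≡hj)) , ρ<hj , rightmost
        where
        ρ : Fin n
        ρ = proj₁ (topRow j)
        ρ+1≡hj : suc (toℕ ρ) ≡ height j
        ρ+1≡hj = proj₂ (topRow j)
        ρ<hj : toℕ ρ < height j
        ρ<hj = subst (toℕ ρ <_) ρ+1≡hj ℕP.≤-refl
        rightmost : ∀ j' → ColAtRight k j' → toℕ ρ < height j' → toℕ j' ≤ toℕ j
        rightmost j' (_ , inj₁ j'≡k) _ = subst (_≤ toℕ j) (sym j'≡k) k≤j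
        rightmost j' (_ , inj₂ first') ρ<hj' =
          ℕP.≤-trans (subst (_≤ cover (height j)) first' (cover-anti (subst (_≤ height j') ρ+1≡hj ρ<hj')))
                     (cover-height≤ j)

    -- Order facts: the columns come in the order  right j₀ … right (n-1),
    -- left 0 … left (n-1),  right 0 … right (j₀-1).
    right-before-left : ∀ {j'} r → k ≤ toℕ j' → rankOf (right j') < rankOf (left r)
    right-before-left {j'} r k≤j' =
      earlier (subst₂ _<_ (sym (place-right-after j' k≤j')) (sym (place-left r)) (right<left j' r))

    left-before-left : ∀ {r r'} → toℕ r' < toℕ r → rankOf (left r') < rankOf (left r)
    left-before-left {r} {r'} r'<r =
      earlier (subst₂ _<_ (sym (place-left r')) (sym (place-left r)) (ℕP.+-monoʳ-< (n ℕ.+ n) r'<r))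

    right-before-right : ∀ {j' j} → k ≤ toℕ j' → toℕ j' < toℕ j → rankOf (right j') < rankOf (right j)
    right-before-right {j'} {j} k≤j' j'<j =
      earlier (subst₂ _<_ (sym (place-right-after j' k≤j')) (sym (place-right-after j (ℕP.≤-trans k≤j' (ℕP.<⇒≤ j'<j))))
                          (ℕP.+-monoʳ-< n j'<j))

    after-before-wrapped : ∀ {j' j} → k ≤ toℕ j' → toℕ j < k → rankOf (right j') < rankOf (right j)
    after-before-wrapped {j'} {j} k≤j' j<k =
      earlier (subst₂ _<_ (sym (place-right-after j' k≤j')) (sym (place-right-before j j<k))
                          (ℕP.<-≤-trans (ℕP.+-monoʳ-< n (FP.toℕ<n j')) (ℕP.m≤m+n (n ℕ.+ n) _)))

    left-before-wrapped : ∀ r {j} → toℕ j < k → rankOf (left r) < rankOf (right j)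
    left-before-wrapped r {j} j<k = earlier (subst₂ _<_ (sym (place-left r)) (sym (place-right-before j j<k))
                                              (ℕP.+-monoʳ-< (n ℕ.+ n) (ℕP.<-≤-trans (FP.toℕ<n r) (ℕP.m≤m+n n (toℕ j)))))

    -- A right column j ∉ T is related to the column  b = k ⊔ cover (height j),
    -- which lies in T and has the height of j.
    dependent-right-column : ∀ j → toℕ j < k ⊎ (k < toℕ j × ¬ First j) → EarlierDependence T (right j)
    dependent-right-column j outside =
      dependence (right j) (toℕ j) b (inj₁ (j , refl , refl , b≢j)) rs ls
      where
      b : ℕ
      b = k ⊔ cover (height j)
      jb : Fin n
      jb = proj₁ (finAt b (ℕP.⊔-lub (FP.toℕ<n j₀) (cover-height<n j)))
      jb≡b : toℕ jb ≡ b
      jb≡b = proj₂ (finAt b (ℕP.⊔-lub (FP.toℕ<n j₀) (cover-height<n j)))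
      hjb≤hj : height jb ≤ height j
      hjb≤hj = height≤-of-cover (subst (cover (height j) ≤_) (sym jb≡b) (ℕP.m≤n⊔m k _))
      b<j : k < toℕ j → ¬ First j → b < toℕ j
      b<j k<j ¬first = ℕP.⊔-lub k<j (ℕP.≤∧≢⇒< (cover-height≤ j) ¬first)
      b≢j : b ≢ toℕ j
      b≢j b≡j = distinct outside
        where
        distinct : toℕ j < k ⊎ (k < toℕ j × ¬ First j) → ⊥
        distinct (inj₁ j<k)            = ℕP.<⇒≱ j<k (subst (k ≤_) b≡j (ℕP.m≤m⊔n k _))
        distinct (inj₂ (k<j , ¬first)) = ℕP.<-irrefl b≡j (b<j k<j ¬first)
      rs : ∀ j' → (toℕ j' ≡ toℕ j ⊎ toℕ j' ≡ b) → right j' ≢ right j →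
           right j' ∈ T × rankOf (right j') < rankOf (right j)
      rs j' (inj₁ e) j'≢j = contradiction e (right≢⇒toℕ≢ j'≢j)
      rs j' (inj₂ e) _ = inCol (max-in j' _ e) , earlier-than-j outside
        where
        k≤j' : k ≤ toℕ j'
        k≤j' = subst (k ≤_) (sym e) (ℕP.m≤m⊔n k _)
        earlier-than-j : toℕ j < k ⊎ (k < toℕ j × ¬ First j) → rankOf (right j') < rankOf (right j)
        earlier-than-j (inj₁ j<k)            = after-before-wrapped k≤j' j<k
        earlier-than-j (inj₂ (k<j , ¬first)) = right-before-right k≤j' (subst (_< toℕ j) (sym e) (b<j k<j ¬first))
      ls : ∀ r' → CoveredByOne (toℕ j) b r' → left r' ≢ right j →
           left r' ∈ T × rankOf (left r') < rankOf (right j)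
      ls r' (inj₂ (¬j<c , b<c)) _ =
        contradiction (cover-above (ℕP.<-≤-trans (cover-below (subst (_< cover (toℕ r')) (sym jb≡b) b<c)) hjb≤hj)) ¬j<c
      ls r' (inj₁ (j<c , ¬b<c)) _ = row-case outside
        where
        r'<hj : toℕ r' < height j
        r'<hj = cover-below j<c
        hjb≤r' : height jb ≤ toℕ r'
        hjb≤r' = ℕP.≮⇒≥ λ r'<hjb → ¬b<c (subst (_< cover (toℕ r')) jb≡b (cover-above r'<hjb))
        -- no column j₃ ≥ j₀ has height r' + 1: those left of jb are taller
        -- than j, those from jb on are at most as tall as jb
        no-height-after : RowAtRight k r'
        no-height-after j₃ k≤j₃ hj₃≡ with toℕ j₃ <? b
        ... | yes j₃<b = ℕP.<-irrefl refl (ℕP.<-≤-trans r'<hj (ℕP.≤-pred (subst (height j <_) hj₃≡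
                           (cover-below (below-max j₃<b k≤j₃)))))
        ... | no  j₃≮b = ℕP.<-irrefl refl (subst (_≤ toℕ r') hj₃≡
                           (ℕP.≤-trans (height-anti (subst (_≤ toℕ j₃) (sym jb≡b) (ℕP.≮⇒≥ j₃≮b))) hjb≤r'))
        row-case : toℕ j < k ⊎ (k < toℕ j × ¬ First j) → left r' ∈ T × rankOf (left r') < rankOf (right j)
        row-case (inj₁ j<k) = inRow no-height-after , left-before-wrapped r' j<k
        -- for j > j₀, jb has the height of j, so it covers r' too
        row-case (inj₂ (k<j , ¬first)) = contradiction (subst (_< cover (toℕ r')) jb≡b (cover-above r'<hjb)) ¬b<c
          where
          r'<hjb : toℕ r' < height jb
          r'<hjb = subst (toℕ r' <_) (sym (ℕP.≤-antisym hjb≤hj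
                     (height-anti (subst (_≤ toℕ j) (sym jb≡b) (ℕP.<⇒≤ (b<j k<j ¬first)))))) r'<hj

    -- An identity column left r ∉ T, i.e. r + 1 = height j₁ for some j₁ ≥ j₀,
    -- is the relation between the columns  k ⊔ cover (r + 1)  and  cover r.
    dependent-row : ∀ r j₁ → k ≤ toℕ j₁ → height j₁ ≡ suc (toℕ r) → EarlierDependence T (left r)
    dependent-row r j₁ k≤j₁ hj₁≡ =
      dependence (left r) a (cover (toℕ r)) (inj₂ (r , refl , a<cr , ℕP.<-irrefl refl)) rs ls
      where
      a : ℕ
      a = k ⊔ cover (suc (toℕ r))
      a≤j₁ : a ≤ toℕ j₁
      a≤j₁ = ℕP.⊔-lub k≤j₁ (cover≤-of-height (ℕP.≤-reflexive hj₁≡))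
      ja : Fin n
      ja = proj₁ (finAt a (ℕP.≤-<-trans a≤j₁ (FP.toℕ<n j₁)))
      ja≡a : toℕ ja ≡ a
      ja≡a = proj₂ (finAt a (ℕP.≤-<-trans a≤j₁ (FP.toℕ<n j₁)))
      hja≡ : height ja ≡ suc (toℕ r)
      hja≡ = ℕP.≤-antisym (height≤-of-cover (subst (cover (suc (toℕ r)) ≤_) (sym ja≡a) (ℕP.m≤n⊔m k _)))
                          (subst (_≤ height ja) hj₁≡ (height-anti (subst (_≤ toℕ j₁) (sym ja≡a) a≤j₁)))
      j₁<cr : toℕ j₁ < cover (toℕ r)
      j₁<cr = cover-above (subst (toℕ r <_) (sym hj₁≡) ℕP.≤-refl)
      a<cr : a < cover (toℕ r)
      a<cr = ℕP.≤-<-trans a≤j₁ j₁<cr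
      rs : ∀ j' → (toℕ j' ≡ a ⊎ toℕ j' ≡ cover (toℕ r)) → right j' ≢ left r →
           right j' ∈ T × rankOf (right j') < rankOf (left r)
      rs j' (inj₁ e) _ = inCol (max-in j' _ e) , right-before-left r (subst (k ≤_) (sym e) (ℕP.m≤m⊔n k _))
      rs j' (inj₂ e) _ = inCol (k≤j' , inj₂ (first-at-cover j' _ e)) , right-before-left r k≤j'
        where
        k≤j' : k ≤ toℕ j'
        k≤j' = subst (k ≤_) (sym e) (ℕP.<⇒≤ (ℕP.≤-<-trans k≤j₁ j₁<cr))
      ls : ∀ r' → CoveredByOne a (cover (toℕ r)) r' → left r' ≢ left r →
           left r' ∈ T × rankOf (left r') < rankOf (left r)
      ls r' (inj₂ (¬a<c , cr<c)) _ =
        contradiction (subst (_< cover (toℕ r')) ja≡a (cover-above (subst (toℕ r' <_) (sym hja≡)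
                         (ℕP.<-trans (cover-<⇒> cr<c) ℕP.≤-refl)))) ¬a<c
      ls r' (inj₁ (a<c , ¬grow)) r'≢r = inRow (λ j₃ _ → no-height r'<r ¬grow j₃) , left-before-left r'<r
        where
        r'<r : toℕ r' < toℕ r
        r'<r = ℕP.≤∧≢⇒< (ℕP.≤-pred (subst (toℕ r' <_) hja≡
                           (cover-below (subst (_< cover (toℕ r')) (sym ja≡a) a<c))))
                        (left≢⇒toℕ≢ r'≢r)

    dependentAtRight : ∀ x → x ∉ T → EarlierDependence T x
    dependentAtRight x x∉T with column-cases x
    ... | inj₂ (j , refl) = dependent-right-column j (¬colAtRight (λ col → x∉T (inCol col)))
    ... | inj₁ (r , refl) with ¬rowAtRight (λ row → x∉T (inRow row))
    ...   | j₁ , k≤j₁ , hj₁≡ = dependent-row r j₁ k≤j₁ hj₁≡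

module Transitions (n : ℕ) (A : Fin n → Fin n → ℚ) (dyck : IsDyck A) where

  open Prelims
  open Heights n A dyck
  open PsiLinear n A dyck
  open Necklace n A dyck
  open import Data.Nat as ℕ using (suc; _<_; _≤_; _<?_; z≤n; s≤s)
  import Data.Nat.Properties as ℕP
  open import Data.Fin using (toℕ)
  import Data.Fin.Properties as FP
  open import Data.Fin.Subset using (Subset; _∈_; _⊆_; _-_; _∪_; ⁅_⁆)
  import Data.Fin.Subset.Properties as SP
  open import Data.Product using (Σ; _×_; _,_; proj₁; proj₂)
  open import Data.Sum using (_⊎_; inj₁; inj₂)
  open import Function using (_∘_; mk⇔)
  open import Relation.Nullary using (yes; no; contradiction)
  open import Relation.Binary.PropositionalEquality

  -- The sets at the two ends of each half agree: the left start at i = n is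
  -- the right start at 0, and the right start at n is the left start at 0.
  -- (They make the necklace close up into a cycle.)

  leftSet-n : leftSet n ≡ rightSet 0
  leftSet-n = columns-cong (rowAtLeft? n) (rowAtRight? 0) (colAtLeft? n) (colAtRight? 0)
    (λ r → mk⇔ (to r) (from r)) (λ j → mk⇔ (toC j) (fromC j))
    where
    to : ∀ r → RowAtLeft n r → RowAtRight 0 r
    to r (inj₁ n≤r)          = contradiction n≤r (ℕP.<⇒≱ (FP.toℕ<n r))
    to r (inj₂ (_ , no-hgt)) = λ j _ → no-hgt j
    from : ∀ r → RowAtRight 0 r → RowAtLeft n r
    from r no-hgt = inj₂ (r+1<n , λ j → no-hgt j z≤n)
      where
      j₀ : Fin n
      j₀ = proj₁ (finAt 0 (ℕP.≤-<-trans z≤n (FP.toℕ<n r)))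
      j₀≡0 : toℕ j₀ ≡ 0
      j₀≡0 = proj₂ (finAt 0 (ℕP.≤-<-trans z≤n (FP.toℕ<n r)))
      -- r + 1 = n would be the height of column 0
      r+1<n : suc (toℕ r) < n
      r+1<n = ℕP.≤∧≢⇒< (FP.toℕ<n r) λ r+1≡n → no-hgt j₀ z≤n (trans (height-first j₀ j₀≡0) (sym r+1≡n))
    toC : ∀ j → ColAtLeft n j → ColAtRight 0 j
    toC j (_ , first , _) = z≤n , inj₂ first
    fromC : ∀ j → ColAtRight 0 j → ColAtLeft n j
    fromC j (_ , which) = ℕP.≤-<-trans z≤n (FP.toℕ<n j) , first which , short
      where
      first : toℕ j ≡ 0 ⊎ First j → First j
      first (inj₁ j≡0) = first-zero j j≡0
      first (inj₂ f)   = f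
      short : height j < n ⊎ height j ≡ n
      short with height j ℕ.≟ n
      ... | yes h≡n = inj₂ h≡n
      ... | no  h≢n = inj₁ (ℕP.≤∧≢⇒< (height≤n j) h≢n)

  rightSet-n : rightSet n ≡ leftSet 0
  rightSet-n = columns-cong (rowAtRight? n) (rowAtLeft? 0) (colAtRight? n) (colAtLeft? 0)
    (λ r → mk⇔ (λ _ → inj₁ z≤n) (λ _ j n≤j → contradiction n≤j (ℕP.<⇒≱ (FP.toℕ<n j))))
    (λ j → mk⇔ (λ (n≤j , _) → contradiction n≤j (ℕP.<⇒≱ (FP.toℕ<n j)))
                (λ (0<0 , _) → contradiction 0<0 (ℕP.<-irrefl refl)))

  module _ (i : ℕ) where
    rowL⁺ : ∀ {r} → RowAtLeft i r → left r ∈ leftSet i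
    rowL⁺ = left∈⁺ (rowAtLeft? i) (colAtLeft? i)
    rowL⁻ : ∀ {r} → left r ∈ leftSet i → RowAtLeft i r
    rowL⁻ = left∈⁻ (rowAtLeft? i) (colAtLeft? i)
    colL⁺ : ∀ {j} → ColAtLeft i j → right j ∈ leftSet i
    colL⁺ = right∈⁺ (rowAtLeft? i) (colAtLeft? i)
    colL⁻ : ∀ {j} → right j ∈ leftSet i → ColAtLeft i j
    colL⁻ = right∈⁻ (rowAtLeft? i) (colAtLeft? i)
    rowR⁺ : ∀ {r} → RowAtRight i r → left r ∈ rightSet i
    rowR⁺ = left∈⁺ (rowAtRight? i) (colAtRight? i)
    rowR⁻ : ∀ {r} → left r ∈ rightSet i → RowAtRight i r
    rowR⁻ = left∈⁻ (rowAtRight? i) (colAtRight? i)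
    colR⁺ : ∀ {j} → ColAtRight i j → right j ∈ rightSet i
    colR⁺ = right∈⁺ (rowAtRight? i) (colAtRight? i)
    colR⁻ : ∀ {j} → right j ∈ rightSet i → ColAtRight i j
    colR⁻ = right∈⁻ (rowAtRight? i) (colAtRight? i)

  -- The column entering the basis when the start moves from left i to
  -- left (i + 1):  right 0 if i = 0;  the first column of height i if there is
  -- one;  otherwise the identity column of row i - 1.

  LeftStep : Fin n → Fin (n ℕ.+ n) → Set
  LeftStep i₀ y =
      (toℕ i₀ ≡ 0 × Σ (Fin n) λ j → toℕ j ≡ 0 × y ≡ right j)
    ⊎ (1 ≤ toℕ i₀ × Σ (Fin n) λ j → height j ≡ toℕ i₀ × toℕ j ≡ cover (toℕ i₀) × y ≡ right j)
    ⊎ (1 ≤ toℕ i₀ × (∀ j → height j ≢ toℕ i₀) × Σ (Fin n) λ r → suc (toℕ r) ≡ toℕ i₀ × y ≡ left r)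

  module LeftExchange (i₀ : Fin n) (y : Fin (n ℕ.+ n)) (step : LeftStep i₀ y) where
    i : ℕ
    i = toℕ i₀
    S : Subset (n ℕ.+ n)
    S = leftSet i
    new : ∀ {z} → z ≡ y → z ∈ (S - left i₀) ∪ ⁅ y ⁆
    new refl = ∈-exchange-new y
    new⊆old : leftSet (suc i) ⊆ (S - left i₀) ∪ ⁅ y ⁆
    new⊆old {z} z∈ with column-cases z
    new⊆old {z} z∈ | inj₁ (r , refl) = row (rowL⁻ (suc i) z∈)
      where
      row : RowAtLeft (suc i) r → left r ∈ (S - left i₀) ∪ ⁅ y ⁆
      row (inj₁ i<r) = ∈-exchange⁺ (rowL⁺ i (inj₁ (ℕP.<⇒≤ i<r))) (toℕ≢⇒left≢ (ℕP.>⇒≢ i<r))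
      row (inj₂ (r+1≤i , no-hgt)) with suc (toℕ r) <? i
      ... | yes r+1<i = ∈-exchange⁺ (rowL⁺ i (inj₂ (r+1<i , no-hgt)))
                                    (toℕ≢⇒left≢ (ℕP.<⇒≢ (ℕP.<-trans ℕP.≤-refl r+1<i)))
      ... | no  r+1≮i = new (entering step)
        where
        r+1≡i : suc (toℕ r) ≡ i
        r+1≡i = ℕP.≤-antisym (ℕP.≤-pred r+1≤i) (ℕP.≮⇒≥ r+1≮i)
        entering : LeftStep i₀ y → left r ≡ y
        entering (inj₁ (i≡0 , _)) = contradiction (trans r+1≡i i≡0) λ ()
        entering (inj₂ (inj₁ (_ , j , hj≡i , _))) = contradiction (trans hj≡i (sym r+1≡i)) (no-hgt j)
        entering (inj₂ (inj₂ (_ , _ , r₁ , r₁+1≡i , refl))) =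
          cong left (FP.toℕ-injective (ℕP.suc-injective (trans r+1≡i (sym r₁+1≡i))))
    new⊆old {z} z∈ | inj₂ (j , refl) = col (colL⁻ (suc i) z∈)
      where
      col : ColAtLeft (suc i) j → right j ∈ (S - left i₀) ∪ ⁅ y ⁆
      col (_ , first , short) with i ℕ.≟ 0
      ... | yes i≡0 = new (entering step)
        where
        -- no height is below 1
        full : height j < suc i ⊎ height j ≡ n → height j ≡ n
        full (inj₂ e)  = e
        full (inj₁ lt) = contradiction (subst (height j <_) (cong suc i≡0) lt) (ℕP.≤⇒≯ (height≥1 j))
        hj≡n : height j ≡ n
        hj≡n = full short
        entering : LeftStep i₀ y → right j ≡ y
        entering (inj₁ (_ , j' , j'≡0 , refl)) =
          cong right (FP.toℕ-injective (trans (sym first) (trans (cong cover hj≡n) (trans cover-n (sym j'≡0)))))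
        entering (inj₂ (inj₁ (1≤i , _)))        = contradiction (subst (1 ≤_) i≡0 1≤i) λ ()
        entering (inj₂ (inj₂ (1≤i , _)))        = contradiction (subst (1 ≤_) i≡0 1≤i) λ ()
      ... | no i≢0 with short
      ...   | inj₂ hj≡n = ∈-exchange⁺ (colL⁺ i (ℕP.n≢0⇒n>0 i≢0 , first , inj₂ hj≡n)) (λ e → left≢right i₀ j (sym e))
      ...   | inj₁ hj<i+1 with height j <? i
      ...     | yes hj<i = ∈-exchange⁺ (colL⁺ i (ℕP.n≢0⇒n>0 i≢0 , first , inj₁ hj<i)) (λ e → left≢right i₀ j (sym e))
      ...     | no  hj≮i = new (entering step)
        where
        hj≡i : height j ≡ i
        hj≡i = ℕP.≤-antisym (ℕP.≤-pred hj<i+1) (ℕP.≮⇒≥ hj≮i)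
        entering : LeftStep i₀ y → right j ≡ y
        entering (inj₁ (i≡0 , _)) = contradiction i≡0 i≢0
        entering (inj₂ (inj₁ (_ , j₁ , _ , j₁≡c , refl))) =
          cong right (FP.toℕ-injective (trans (sym first) (trans (cong cover hj≡i) (sym j₁≡c))))
        entering (inj₂ (inj₂ (_ , no-hgt , _))) = contradiction hj≡i (no-hgt j)
    old⊆new : (S - left i₀) ∪ ⁅ y ⁆ ⊆ leftSet (suc i)
    old⊆new {z} z∈ with ∈-exchange⁻ z∈
    old⊆new {z} z∈ | inj₁ (z∈S , z≢i₀) with column-cases z
    ... | inj₁ (r , refl) = rowL⁺ (suc i) (grow (rowL⁻ i z∈S))
      where
      grow : RowAtLeft i r → RowAtLeft (suc i) r
      grow (inj₁ i≤r)           = inj₁ (ℕP.≤∧≢⇒< i≤r λ i≡r → z≢i₀ (cong left (FP.toℕ-injective (sym i≡r))))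
      grow (inj₂ (r+1<i , nh)) = inj₂ (ℕP.<-trans r+1<i ℕP.≤-refl , nh)
    ... | inj₂ (j , refl) with colL⁻ i z∈S
    ...   | 0<i , first , short = colL⁺ (suc i) (s≤s z≤n , first , widen short)
      where
      widen : height j < i ⊎ height j ≡ n → height j < suc i ⊎ height j ≡ n
      widen (inj₁ hj<i) = inj₁ (ℕP.<-trans hj<i ℕP.≤-refl)
      widen (inj₂ hj≡n) = inj₂ hj≡n
    old⊆new {z} z∈ | inj₂ refl = entered step
      where
      entered : LeftStep i₀ y → y ∈ leftSet (suc i)
      entered (inj₁ (_ , j , j≡0 , refl)) = colL⁺ (suc i) (s≤s z≤n , first-zero j j≡0 , inj₂ (height-first j j≡0))
      entered (inj₂ (inj₁ (_ , j , hj≡i , j≡c , refl))) =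
        colL⁺ (suc i) (s≤s z≤n , first-at-cover j i j≡c , inj₁ (subst (_< suc i) (sym hj≡i) ℕP.≤-refl))
      entered (inj₂ (inj₂ (_ , no-hgt , r , r+1≡i , refl))) =
        rowL⁺ (suc i) (inj₂ (subst (_< suc i) (sym r+1≡i) ℕP.≤-refl , λ j e → no-hgt j (trans e r+1≡i)))

  leftStep : ∀ i₀ y → LeftStep i₀ y →
             leftSet (suc (toℕ i₀)) ≡ (leftSet (toℕ i₀) - left i₀) ∪ ⁅ y ⁆
  leftStep i₀ y step = SP.⊆-antisym new⊆old old⊆new
    where open LeftExchange i₀ y step

  -- The column entering the basis when the start moves from right j₀ to
  -- right (j₀ + 1):  the next column if it has the same height as j₀,
  -- otherwise the identity column of the top row of column j₀.

  RightStep : Fin n → Fin (n ℕ.+ n) → Set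
  RightStep j₀ y =
      (Σ (Fin n) λ j₁ → toℕ j₁ ≡ suc (toℕ j₀) × height j₁ ≡ height j₀ × y ≡ right j₁)
    ⊎ ((∀ j₁ → toℕ j₁ ≡ suc (toℕ j₀) → height j₁ ≢ height j₀) ×
       Σ (Fin n) λ r → suc (toℕ r) ≡ height j₀ × y ≡ left r)

  module RightExchange (j₀ : Fin n) (y : Fin (n ℕ.+ n)) (step : RightStep j₀ y) where
    k : ℕ
    k = toℕ j₀
    S : Subset (n ℕ.+ n)
    S = rightSet k
    new : ∀ {z} → z ≡ y → z ∈ (S - right j₀) ∪ ⁅ y ⁆
    new refl = ∈-exchange-new y
    new⊆old : rightSet (suc k) ⊆ (S - right j₀) ∪ ⁅ y ⁆
    new⊆old {z} z∈ with column-cases z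
    new⊆old {z} z∈ | inj₁ (r , refl) with height j₀ ℕ.≟ suc (toℕ r)
    ... | no  hj₀≢ = ∈-exchange⁺ (rowR⁺ k free) (left≢right r j₀)
      where
      free : RowAtRight k r
      free j k≤j with toℕ j ℕ.≟ k
      ... | yes j≡k = subst (λ j' → height j' ≢ suc (toℕ r)) (sym (FP.toℕ-injective j≡k)) hj₀≢
      ... | no  j≢k = rowR⁻ (suc k) z∈ j (ℕP.≤∧≢⇒< k≤j (j≢k ∘ sym))
    ... | yes hj₀≡ = new (entering step)
      where
      entering : RightStep j₀ y → left r ≡ y
      entering (inj₁ (j₁ , j₁≡ , hj₁≡ , _)) =
        contradiction (trans hj₁≡ hj₀≡) (rowR⁻ (suc k) z∈ j₁ (ℕP.≤-reflexive (sym j₁≡)))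
      entering (inj₂ (_ , r₁ , r₁+1≡ , refl)) =
        cong left (FP.toℕ-injective (ℕP.suc-injective (trans (sym hj₀≡) (sym r₁+1≡))))
    new⊆old {z} z∈ | inj₂ (j , refl) with colR⁻ (suc k) z∈
    ... | k<j , inj₂ first = ∈-exchange⁺ (colR⁺ k (ℕP.<⇒≤ k<j , inj₂ first)) (toℕ≢⇒right≢ (ℕP.>⇒≢ k<j))
    ... | k<j , inj₁ j≡k+1 with height j ℕ.≟ height j₀
    ...   | no  hj≢ = ∈-exchange⁺ (colR⁺ k (ℕP.<⇒≤ k<j , inj₂ (first-step j≡k+1 lower))) (toℕ≢⇒right≢ (ℕP.>⇒≢ k<j))
      where
      lower : height j < height j₀
      lower = ℕP.≤∧≢⇒< (height-anti (ℕP.<⇒≤ k<j)) hj≢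
    ...   | yes hj≡ = new (entering step)
      where
      entering : RightStep j₀ y → right j ≡ y
      entering (inj₁ (j₁ , j₁≡ , _ , refl)) = cong right (FP.toℕ-injective (trans j≡k+1 (sym j₁≡)))
      entering (inj₂ (differ , _)) = contradiction hj≡ (differ j j≡k+1)
    old⊆new : (S - right j₀) ∪ ⁅ y ⁆ ⊆ rightSet (suc k)
    old⊆new {z} z∈ with ∈-exchange⁻ z∈
    old⊆new {z} z∈ | inj₁ (z∈S , z≢j₀) with column-cases z
    ... | inj₁ (r , refl) = rowR⁺ (suc k) (λ j k<j → rowR⁻ k z∈S j (ℕP.<⇒≤ k<j))
    ... | inj₂ (j , refl) with colR⁻ k z∈S
    ...   | _   , inj₁ j≡k   = contradiction (cong right (FP.toℕ-injective j≡k)) z≢j₀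
    ...   | k≤j , inj₂ first =
      colR⁺ (suc k) (ℕP.≤∧≢⇒< k≤j (λ k≡j → z≢j₀ (cong right (FP.toℕ-injective (sym k≡j)))) , inj₂ first)
    old⊆new {z} z∈ | inj₂ refl = entered step
      where
      entered : RightStep j₀ y → y ∈ rightSet (suc k)
      entered (inj₁ (j₁ , j₁≡ , _ , refl)) = colR⁺ (suc k) (ℕP.≤-reflexive (sym j₁≡) , inj₁ j₁≡)
      entered (inj₂ (differ , r , r+1≡ , refl)) = rowR⁺ (suc k) free
        where
        -- a column j > j₀ of height r + 1 = height j₀ would force the next
        -- column to have that height too
        free : RowAtRight (suc k) r
        free j k<j hj≡ = differ j₁ j₁≡ (ℕP.≤-antisym (height-anti (subst (k ≤_) (sym j₁≡) (ℕP.n≤1+n k)))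
                            (subst (_≤ height j₁) (trans hj≡ r+1≡) (height-anti (subst (_≤ toℕ j) (sym j₁≡) k<j))))
          where
          j₁ : Fin n
          j₁ = proj₁ (finAt (suc k) (ℕP.≤-<-trans k<j (FP.toℕ<n j)))
          j₁≡ : toℕ j₁ ≡ suc k
          j₁≡ = proj₂ (finAt (suc k) (ℕP.≤-<-trans k<j (FP.toℕ<n j)))

  rightStep : ∀ j₀ y → RightStep j₀ y →
              rightSet (suc (toℕ j₀)) ≡ (rightSet (toℕ j₀) - right j₀) ∪ ⁅ y ⁆
  rightStep j₀ y step = SP.⊆-antisym new⊆old old⊆new
    where open RightExchange j₀ y step

module Identification (n : ℕ) (A : Fin n → Fin n → ℚ) (dyck : IsDyck A) where

  open Prelims
  open LexMin using (module Greedy)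
  open Heights n A dyck
  open PsiLinear n A dyck
  open Necklace n A dyck
  open Bases n A dyck
  open Transitions n A dyck
  open import Data.Nat as ℕ using (zero; suc; _∸_; _<_; _≤_; _<?_; z≤n)
  import Data.Nat.Properties as ℕP
  open import Data.Fin using (toℕ)
  import Data.Fin.Properties as FP
  open import Data.Fin.Subset using (Subset; _∈_; _∉_; _-_; _∪_; ⁅_⁆; ∣_∣)
  open import Data.Product using (Σ; _×_; _,_; proj₁; proj₂)
  open import Data.Sum using (inj₁; inj₂)
  open import Function using (_∘_)
  open import Relation.Nullary using (Dec; yes; no; ¬_; contradiction)
  open import Relation.Binary.PropositionalEquality

  start∈leftSet : ∀ i₀ → left i₀ ∈ leftSet (toℕ i₀)
  start∈leftSet i₀ = rowL⁺ (toℕ i₀) (inj₁ ℕP.≤-refl)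

  start∈rightSet : ∀ j₀ → right j₀ ∈ rightSet (toℕ j₀)
  start∈rightSet j₀ = colR⁺ (toℕ j₀) (ℕP.≤-refl , inj₁ refl)

  chooseLeftStep : ∀ i₀ → Σ (Fin (n ℕ.+ n)) λ y → LeftStep i₀ y × y ∉ leftSet (toℕ i₀)
  chooseLeftStep i₀ with toℕ i₀ ℕ.≟ 0
  ... | yes i≡0 = right j₀ , inj₁ (i≡0 , j₀ , j₀≡0 , refl) ,
                  λ y∈ → ℕP.<-irrefl (sym i≡0) (proj₁ (colL⁻ (toℕ i₀) y∈))
    where
    j₀ : Fin n
    j₀ = proj₁ (finAt 0 (ℕP.≤-<-trans z≤n (FP.toℕ<n i₀)))
    j₀≡0 : toℕ j₀ ≡ 0
    j₀≡0 = proj₂ (finAt 0 (ℕP.≤-<-trans z≤n (FP.toℕ<n i₀)))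
  ... | no i≢0 with no-height? (toℕ i₀)
  ...   | yes none = left r , inj₂ (inj₂ (ℕP.n≢0⇒n>0 i≢0 , none , r , r+1≡i , refl)) , r∉
    where
    r : Fin n
    r = proj₁ (prevRow (ℕP.n≢0⇒n>0 i≢0) (ℕP.<⇒≤ (FP.toℕ<n i₀)))
    r+1≡i : suc (toℕ r) ≡ toℕ i₀
    r+1≡i = proj₂ (prevRow (ℕP.n≢0⇒n>0 i≢0) (ℕP.<⇒≤ (FP.toℕ<n i₀)))
    r∉ : left r ∉ leftSet (toℕ i₀)
    r∉ r∈ = excluded (rowL⁻ (toℕ i₀) r∈)
      where
      excluded : ¬ RowAtLeft (toℕ i₀) r
      excluded (inj₁ i≤r)         = ℕP.<-irrefl refl (subst (_≤ toℕ r) (sym r+1≡i) i≤r)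
      excluded (inj₂ (r+1<i , _)) = ℕP.<-irrefl r+1≡i r+1<i
  ...   | no ¬none = right j₁ , inj₂ (inj₁ (ℕP.n≢0⇒n>0 i≢0 , j₁ , hj₁≡i , j₁≡c , refl)) , j₁∉
    where
    j : Fin n
    j = proj₁ (some-height (toℕ i₀) ¬none)
    hj≡i : height j ≡ toℕ i₀
    hj≡i = proj₂ (some-height (toℕ i₀) ¬none)
    c<n : cover (toℕ i₀) < n
    c<n = subst (_< n) (cong cover hj≡i) (cover-height<n j)
    j₁ : Fin n
    j₁ = proj₁ (finAt (cover (toℕ i₀)) c<n)
    j₁≡c : toℕ j₁ ≡ cover (toℕ i₀)
    j₁≡c = proj₂ (finAt (cover (toℕ i₀)) c<n)
    hj₁≡i : height j₁ ≡ toℕ i₀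
    hj₁≡i = trans (height-at-cover j j₁ (trans j₁≡c (cong cover (sym hj≡i)))) hj≡i
    excluded : ¬ ColAtLeft (toℕ i₀) j₁
    excluded (_ , _ , inj₁ hj₁<i) = ℕP.<-irrefl hj₁≡i hj₁<i
    excluded (_ , _ , inj₂ hj₁≡n) = ℕP.<-irrefl (trans (sym hj₁≡i) hj₁≡n) (FP.toℕ<n i₀)
    j₁∉ : right j₁ ∉ leftSet (toℕ i₀)
    j₁∉ j₁∈ = excluded (colL⁻ (toℕ i₀) j₁∈)

  chooseRightStep : ∀ j₀ → Σ (Fin (n ℕ.+ n)) λ y → RightStep j₀ y × y ∉ rightSet (toℕ j₀)
  chooseRightStep j₀ = choose (suc (toℕ j₀) <? n)
    where
    k : ℕ
    k = toℕ j₀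
    r : Fin n
    r = proj₁ (topRow j₀)
    r+1≡ : suc (toℕ r) ≡ height j₀
    r+1≡ = proj₂ (topRow j₀)
    top : (∀ j₁ → toℕ j₁ ≡ suc k → height j₁ ≢ height j₀) →
          Σ (Fin (n ℕ.+ n)) λ y → RightStep j₀ y × y ∉ rightSet k
    top differ = left r , inj₂ (differ , r , r+1≡ , refl) ,
                 λ r∈ → rowR⁻ k r∈ j₀ ℕP.≤-refl (sym r+1≡)
    choose : Dec (suc k < n) → Σ (Fin (n ℕ.+ n)) λ y → RightStep j₀ y × y ∉ rightSet k
    choose (no last) = top (λ j₁ j₁≡ _ → last (subst (_< n) j₁≡ (FP.toℕ<n j₁)))
    choose (yes lt) = compare (height j₁ ℕ.≟ height j₀)
      where
      j₁ : Fin n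
      j₁ = proj₁ (finAt (suc k) lt)
      j₁≡ : toℕ j₁ ≡ suc k
      j₁≡ = proj₂ (finAt (suc k) lt)
      excluded : height j₁ ≡ height j₀ → ¬ ColAtRight k j₁
      excluded same (_ , inj₁ j₁≡k)  = ℕP.<-irrefl (trans (sym j₁≡k) j₁≡) ℕP.≤-refl
      excluded same (_ , inj₂ first) = ℕP.<-irrefl same (first-step⁻ j₁≡ first)
      compare : Dec (height j₁ ≡ height j₀) → Σ (Fin (n ℕ.+ n)) λ y → RightStep j₀ y × y ∉ rightSet k
      compare (yes same) = right j₁ , inj₁ (j₁ , j₁≡ , same , refl) , λ j₁∈ → excluded same (colR⁻ k j₁∈)
      compare (no differ) = top λ j₁' j₁'≡ → subst (λ j → height j ≢ height j₀)
                                                (FP.toℕ-injective (trans j₁≡ (sym j₁'≡))) differ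

  necklaceAt : ℕ → Subset (n ℕ.+ n)
  necklaceAt v with v <? n
  ... | yes _ = leftSet v
  ... | no  _ = rightSet (v ∸ n)

  necklace : Fin (n ℕ.+ n) → Subset (n ℕ.+ n)
  necklace c = necklaceAt (toℕ c)

  necklaceAt-left : ∀ {v} → v < n → necklaceAt v ≡ leftSet v
  necklaceAt-left {v} v<n with v <? n
  ... | yes _  = refl
  ... | no v≮n = contradiction v<n v≮n

  necklaceAt-right : ∀ {v} → n ≤ v → necklaceAt v ≡ rightSet (v ∸ n)
  necklaceAt-right {v} n≤v with v <? n
  ... | yes v<n = contradiction n≤v (ℕP.<⇒≱ v<n)
  ... | no  _   = refl

  necklace-left : ∀ r → necklace (left r) ≡ leftSet (toℕ r)
  necklace-left r rewrite toℕ-left r = necklaceAt-left (FP.toℕ<n r)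

  necklace-right : ∀ j → necklace (right j) ≡ rightSet (toℕ j)
  necklace-right j rewrite toℕ-right j =
    trans (necklaceAt-right (ℕP.m≤m+n n (toℕ j))) (cong rightSet (ℕP.m+n∸m≡n n (toℕ j)))

  next-step : ∀ {m} (c : Fin m) → suc (toℕ c) < m → toℕ (next c) ≡ suc (toℕ c)
  next-step {suc m} c lt with suc (toℕ c) <? suc m
  ... | yes p = FP.toℕ-fromℕ< p
  ... | no ¬p = contradiction lt ¬p

  next-wrap : ∀ {m} (c : Fin m) → ¬ suc (toℕ c) < m → toℕ (next c) ≡ 0
  next-wrap {suc m} c ¬lt with suc (toℕ c) <? suc m
  ... | yes p = contradiction p ¬lt
  ... | no  _ = refl

  necklace-next-left : ∀ i₀ → necklace (next (left i₀)) ≡ leftSet (suc (toℕ i₀))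
  necklace-next-left i₀ with suc (toℕ i₀) <? n
  ... | yes i+1<n = trans (cong necklaceAt (trans (next-step (left i₀) i+1<2n) (cong suc (toℕ-left i₀))))
                          (necklaceAt-left i+1<n)
    where
    i+1<2n : suc (toℕ (left i₀)) < n ℕ.+ n
    i+1<2n = subst (λ v → suc v < n ℕ.+ n) (sym (toℕ-left i₀)) (ℕP.<-≤-trans i+1<n (ℕP.m≤m+n n n))
  ... | no  i+1≮n = begin
    necklaceAt (toℕ (next (left i₀))) ≡⟨ cong necklaceAt (trans (next-step (left i₀) i+1<2n)
                                                                (trans (cong suc (toℕ-left i₀)) i+1≡n)) ⟩
    necklaceAt n                      ≡⟨ necklaceAt-right ℕP.≤-refl ⟩
    rightSet (n ∸ n)                  ≡⟨ cong rightSet (ℕP.n∸n≡0 n) ⟩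
    rightSet 0                        ≡⟨ sym leftSet-n ⟩
    leftSet n                         ≡⟨ cong leftSet (sym i+1≡n) ⟩
    leftSet (suc (toℕ i₀))            ∎
    where
    open ≡-Reasoning
    i+1≡n : suc (toℕ i₀) ≡ n
    i+1≡n = ℕP.≤-antisym (FP.toℕ<n i₀) (ℕP.≮⇒≥ i+1≮n)
    i+1<2n : suc (toℕ (left i₀)) < n ℕ.+ n
    i+1<2n = subst (_< n ℕ.+ n) (sym (trans (cong suc (toℕ-left i₀)) i+1≡n))
                   (ℕP.m<m+n n (ℕP.≤-<-trans z≤n (FP.toℕ<n i₀)))

  necklace-next-right : ∀ j₀ → necklace (next (right j₀)) ≡ rightSet (suc (toℕ j₀))
  necklace-next-right j₀ with suc (toℕ j₀) <? n
  ... | yes k+1<n = begin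
    necklaceAt (toℕ (next (right j₀))) ≡⟨ cong necklaceAt (trans (next-step (right j₀) not-last) idx) ⟩
    necklaceAt (n ℕ.+ suc (toℕ j₀))    ≡⟨ necklaceAt-right (ℕP.m≤m+n n _) ⟩
    rightSet (n ℕ.+ suc (toℕ j₀) ∸ n)  ≡⟨ cong rightSet (ℕP.m+n∸m≡n n _) ⟩
    rightSet (suc (toℕ j₀))            ∎
    where
    open ≡-Reasoning
    idx : suc (toℕ (right j₀)) ≡ n ℕ.+ suc (toℕ j₀)
    idx = trans (cong suc (toℕ-right j₀)) (sym (ℕP.+-suc n (toℕ j₀)))
    not-last : suc (toℕ (right j₀)) < n ℕ.+ n
    not-last = subst (_< n ℕ.+ n) (sym idx) (ℕP.+-monoʳ-< n k+1<n)
  ... | no k+1≮n = begin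
    necklaceAt (toℕ (next (right j₀))) ≡⟨ cong necklaceAt (next-wrap (right j₀) last) ⟩
    necklaceAt 0                       ≡⟨ necklaceAt-left (ℕP.≤-<-trans z≤n (FP.toℕ<n j₀)) ⟩
    leftSet 0                          ≡⟨ sym rightSet-n ⟩
    rightSet n                         ≡⟨ cong rightSet (sym k+1≡n) ⟩
    rightSet (suc (toℕ j₀))            ∎
    where
    open ≡-Reasoning
    k+1≡n : suc (toℕ j₀) ≡ n
    k+1≡n = ℕP.≤-antisym (FP.toℕ<n j₀) (ℕP.≮⇒≥ k+1≮n)
    last : ¬ suc (toℕ (right j₀)) < n ℕ.+ n
    last lt = ℕP.<-irrefl refl (subst (_< n ℕ.+ n)
                (trans (cong suc (toℕ-right j₀)) (trans (sym (ℕP.+-suc n (toℕ j₀))) (cong (n ℕ.+_) k+1≡n))) lt)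

  necklace-leftStep : ∀ i₀ y → LeftStep i₀ y →
    necklace (next (left i₀)) ≡ (necklace (left i₀) - left i₀) ∪ ⁅ y ⁆
  necklace-leftStep i₀ y step =
    trans (necklace-next-left i₀)
          (trans (leftStep i₀ y step) (cong (λ S → (S - left i₀) ∪ ⁅ y ⁆) (sym (necklace-left i₀))))

  necklace-rightStep : ∀ j₀ y → RightStep j₀ y →
    necklace (next (right j₀)) ≡ (necklace (right j₀) - right j₀) ∪ ⁅ y ⁆
  necklace-rightStep j₀ y step =
    trans (necklace-next-right j₀)
          (trans (rightStep j₀ y step) (cong (λ S → (S - right j₀) ∪ ⁅ y ⁆) (sym (necklace-right j₀))))

  exchange : ∀ c → Σ (Fin (n ℕ.+ n)) λ y →
    necklace (next c) ≡ (necklace c - c) ∪ ⁅ y ⁆ × c ∈ necklace c × y ∉ necklace c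
  exchange c with column-cases c
  ... | inj₁ (i₀ , refl) =
    y , necklace-leftStep i₀ y step ,
    subst (left i₀ ∈_) (sym (necklace-left i₀)) (start∈leftSet i₀) ,
    subst (y ∉_) (sym (necklace-left i₀)) y∉
    where
    y : Fin (n ℕ.+ n)
    y = proj₁ (chooseLeftStep i₀)
    step : LeftStep i₀ y
    step = proj₁ (proj₂ (chooseLeftStep i₀))
    y∉ : y ∉ leftSet (toℕ i₀)
    y∉ = proj₂ (proj₂ (chooseLeftStep i₀))
  ... | inj₂ (j₀ , refl) =
    y , necklace-rightStep j₀ y step ,
    subst (right j₀ ∈_) (sym (necklace-right j₀)) (start∈rightSet j₀) ,
    subst (y ∉_) (sym (necklace-right j₀)) y∉
    where
    y : Fin (n ℕ.+ n)
    y = proj₁ (chooseRightStep j₀)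
    step : RightStep j₀ y
    step = proj₁ (proj₂ (chooseRightStep j₀))
    y∉ : y ∉ rightSet (toℕ j₀)
    y∉ = proj₂ (proj₂ (chooseRightStep j₀))

  -- Every set of the necklace has n elements: the first one, leftSet 0,
  -- consists of the n identity columns, and exchanges preserve the size.

  ∣leftSet0∣ : ∣ leftSet 0 ∣ ≡ n
  ∣leftSet0∣ = ∣columns∣-identity (rowAtLeft? 0) (colAtLeft? 0) (λ r → inj₁ z≤n)
                                  (λ j (0<0 , _) → ℕP.<-irrefl refl 0<0)

  ∣necklace∣ : ∀ c → ∣ necklace c ∣ ≡ n
  ∣necklace∣ c = go (toℕ c) c refl
    where
    go : ∀ p (c : Fin (n ℕ.+ n)) → toℕ c ≡ p → ∣ necklace c ∣ ≡ n
    go zero c c≡0 =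
      trans (cong ∣_∣ (trans (cong necklaceAt c≡0) (necklaceAt-left (nonempty c)))) ∣leftSet0∣
    go (suc p) c c≡ = begin
      ∣ necklace c ∣                       ≡⟨ cong (∣_∣ ∘ necklace) (sym next-c') ⟩
      ∣ necklace (next c') ∣               ≡⟨ cong ∣_∣ (proj₁ (proj₂ (exchange c'))) ⟩
      ∣ (necklace c' - c') ∪ ⁅ y ⁆ ∣       ≡⟨ ∣exchange∣ (necklace c') (proj₁ (proj₂ (proj₂ (exchange c'))))
                                                                  (proj₂ (proj₂ (proj₂ (exchange c')))) ⟩
      ∣ necklace c' ∣                      ≡⟨ go p c' c'≡p ⟩
      n                                   ∎
      where
      open ≡-Reasoning
      p<2n : p < n ℕ.+ n
      p<2n = ℕP.<-trans ℕP.≤-refl (subst (_< n ℕ.+ n) c≡ (FP.toℕ<n c))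
      c' : Fin (n ℕ.+ n)
      c' = proj₁ (finAt p p<2n)
      c'≡p : toℕ c' ≡ p
      c'≡p = proj₂ (finAt p p<2n)
      y : Fin (n ℕ.+ n)
      y = proj₁ (exchange c')
      next-c' : next c' ≡ c
      next-c' = FP.toℕ-injective
        (trans (next-step c' (subst (_< n ℕ.+ n) (trans c≡ (cong suc (sym c'≡p))) (FP.toℕ<n c)))
               (trans (cong suc c'≡p) (sym c≡)))

  necklace-basis : ∀ c → IsBasis B (necklace c)
  necklace-basis c with column-cases c
  ... | inj₁ (i₀ , refl) =
    ∣necklace∣ (left i₀) , subst (LinIndep B) (sym (necklace-left i₀)) (AtLeft.independentAtLeft i₀)
  ... | inj₂ (j₀ , refl) =
    ∣necklace∣ (right j₀) , subst (LinIndep B) (sym (necklace-right j₀)) (AtRight.independentAtRight j₀)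

  lexMin-is-necklace : ∀ (N : Fin (n ℕ.+ n) → Subset (n ℕ.+ n)) → (∀ c → IsLexMinBasis B c (N c)) →
                       ∀ c → N c ≡ necklace c
  lexMin-is-necklace N lexMin c with column-cases c
  ... | inj₁ (i₀ , refl) = Greedy.greedy-lexMin B (left i₀) (necklace (left i₀)) (N (left i₀))
      (necklace-basis (left i₀)) (subst (λ S → ∀ x → x ∉ S → Greedy.EarlierDependence B (left i₀) S x)
                                        (sym (necklace-left i₀)) (AtLeft.dependentAtLeft i₀))
      (lexMin (left i₀))
  ... | inj₂ (j₀ , refl) = Greedy.greedy-lexMin B (right j₀) (necklace (right j₀)) (N (right j₀))
      (necklace-basis (right j₀)) (subst (λ S → ∀ x → x ∉ S → Greedy.EarlierDependence B (right j₀) S x)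
                                         (sym (necklace-right j₀)) (AtRight.dependentAtRight j₀))
      (lexMin (right j₀))

module Clauses (n : ℕ) (A : Fin n → Fin n → ℚ) (dyck : IsDyck A)
  (N : Fin (n Data.Nat.+ n) → Subset (n Data.Nat.+ n))
  (lexMin : ∀ c → IsLexMinBasis (psi A) c (N c)) where

  open Prelims
  open Heights n A dyck
  open PsiLinear n A dyck
  open Transitions n A dyck
  open Identification n A dyck
  open import Data.Nat as ℕ using (suc; _∸_; _<_; _≤_; _<?_; s≤s)
  import Data.Nat.Properties as ℕP
  open import Data.Fin using (toℕ)
  import Data.Fin.Properties as FP
  open import Data.Fin.Subset using (_-_; _∪_; ⁅_⁆)
  open import Data.Product using (Σ; ∃-syntax; _×_; _,_; proj₁; proj₂)
  open import Data.Sum using (inj₁; inj₂)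
  open import Relation.Nullary using (yes; no; ¬_; contradiction)
  open import Relation.Nullary.Decidable using (decidable-stable)
  open import Function using (_∘_)
  open import Relation.Binary.PropositionalEquality

  sigma : ∀ i j → j ≢ i → necklace (next i) ≡ (necklace i - i) ∪ ⁅ j ⁆ → SigmaMaps N j i
  sigma i j j≢i step =
    inj₁ (j≢i , trans (N≡ (next i)) (trans step (cong (λ S → (S - i) ∪ ⁅ j ⁆) (sym (N≡ i)))))
    where
    N≡ : ∀ c → N c ≡ necklace c
    N≡ = lexMin-is-necklace N lexMin

  pos-left : ∀ r → pos (left r) ≡ suc (toℕ r)
  pos-left r = cong suc (toℕ-left r)

  pos-right : ∀ j → pos (right j) ≡ suc (n ℕ.+ toℕ j)
  pos-right j = cong suc (toℕ-right j)

  pos-injective : ∀ {c c' : Fin (n ℕ.+ n)} → pos c ≡ pos c' → c ≡ c'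
  pos-injective e = FP.toℕ-injective (ℕP.suc-injective e)

  right-of-pos : ∀ c → n < pos c → Σ (Fin n) λ j → c ≡ right j
  right-of-pos c n<c with column-cases c
  ... | inj₂ found = found
  ... | inj₁ (r , refl) = contradiction (subst (n <_) (pos-left r) n<c) (ℕP.<⇒≱ (FP.toℕ<n r) ∘ ℕP.≤-pred)

  left-of-pos : ∀ c → pos c ≤ n → Σ (Fin n) λ r → c ≡ left r
  left-of-pos c c≤n with column-cases c
  ... | inj₁ found = found
  ... | inj₂ (j , refl) = contradiction (subst (_≤ n) (pos-right j) c≤n) (ℕP.<⇒≱ (s≤s (ℕP.m≤m+n n (toℕ j))))

  right-adjacent : ∀ j j' → toℕ j ≡ suc (toℕ j') → suc (toℕ (right j')) ≡ toℕ (right j)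
  right-adjacent j j' j≡ = trans (cong suc (toℕ-right j'))
    (trans (sym (ℕP.+-suc n (toℕ j'))) (trans (cong (n ℕ.+_) (sym j≡)) (sym (toℕ-right j))))

  omega-height : ∀ j r → IsOmega B (right j) r → suc (toℕ r) ≡ height j
  omega-height j r (nz , zero-below) = ℕP.≤-antisym r<hj (ℕP.≮⇒≥ λ r+1<hj →
    let (r' , r'≡) = finAt (suc (toℕ r)) (ℕP.<-≤-trans r+1<hj (height≤n j))
    in  sign≢0 r' (trans (sym (B-right-below (subst (_< height j) (sym r'≡) r+1<hj)))
                         (zero-below r' (subst (toℕ r <_) (sym r'≡) ℕP.≤-refl))))
    where
    r<hj : toℕ r < height j
    r<hj = ℕP.≰⇒> λ hj≤r → nz (B-right-above hj≤r)

  height-omega : ∀ j r → suc (toℕ r) ≡ height j → IsOmega B (right j) r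
  height-omega j r r+1≡ = (λ z → sign≢0 r (trans (sym (B-right-below (subst (toℕ r <_) r+1≡ ℕP.≤-refl))) z)) ,
                          (λ r' r<r' → B-right-above (subst (_≤ toℕ r') r+1≡ r<r'))

  same-height-same-column : ∀ {j j'} → height j ≡ height j' → ∀ r → B r (right j) ≡ B r (right j')
  same-height-same-column {j} {j'} same r with toℕ r <? height j
  ... | yes lt = trans (B-right-below lt) (sym (B-right-below (subst (toℕ r <_) same lt)))
  ... | no  ge = trans (B-right-above (ℕP.≮⇒≥ ge)) (sym (B-right-above (subst (_≤ toℕ r) same (ℕP.≮⇒≥ ge))))

  inJ-height : ∀ j j' → toℕ j ≡ suc (toℕ j') → InJ B (right j) → height j ≢ height j'
  inJ-height j j' j≡ (_ , c' , c'+1≡ , differ) same =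
    differ λ r → trans (same-height-same-column same r) (cong (B r) (sym c'≡))
    where
    c'≡ : c' ≡ right j'
    c'≡ = FP.toℕ-injective (ℕP.suc-injective (trans c'+1≡ (sym (right-adjacent j j' j≡))))

  height-inJ : ∀ j j' → toℕ j ≡ suc (toℕ j') → height j ≢ height j' → InJ B (right j)
  height-inJ j j' j≡ differ =
    subst (n <_) (sym (pos-right j)) (s≤s (ℕP.m≤m+n n (toℕ j))) ,
    right j' , right-adjacent j j' j≡ ,
    λ equal → sign≢0 r (trans (sym (B-right-below r<hj')) (trans (sym (equal r)) (B-right-above hj≤r)))
    where
    lower : height j < height j'
    lower = ℕP.≤∧≢⇒< (height-anti (subst (toℕ j' ≤_) (sym j≡) (ℕP.n≤1+n _))) differ
    r : Fin n
    r = proj₁ (finAt (height j) (ℕP.<-≤-trans lower (height≤n j')))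
    r≡ : toℕ r ≡ height j
    r≡ = proj₂ (finAt (height j) (ℕP.<-≤-trans lower (height≤n j')))
    r<hj' : toℕ r < height j'
    r<hj' = subst (_< height j') (sym r≡) lower
    hj≤r : height j ≤ toℕ r
    hj≤r = ℕP.≤-reflexive (sym r≡)

  inJ-first : ∀ j → InJ B (right j) → First j
  inJ-first j inJ with toℕ j ℕ.≟ 0
  ... | yes j≡0 = first-zero j j≡0
  ... | no  j≢0 = first-step j≡ (ℕP.≤∧≢⇒< (height-anti (subst (toℕ j' ≤_) (sym j≡) (ℕP.n≤1+n _))) (inJ-height j j' j≡ inJ))
    where
    j' : Fin n
    j' = proj₁ (predecessor j (ℕP.n≢0⇒n>0 j≢0))
    j≡ : toℕ j ≡ suc (toℕ j')
    j≡ = proj₂ (predecessor j (ℕP.n≢0⇒n>0 j≢0))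

  omega-of-J : ∀ i j r → InJ B j → IsOmega B j r → suc (toℕ r) ≡ i →
               Σ (Fin n) λ j₁ → j ≡ right j₁ × height j₁ ≡ i × toℕ j₁ ≡ cover i
  omega-of-J i j r inJ om r+1≡i with right-of-pos j (proj₁ inJ)
  ... | j₁ , refl = j₁ , refl , hj₁≡i , trans (sym (inJ-first j₁ inJ)) (cong cover hj₁≡i)
    where
    hj₁≡i : height j₁ ≡ i
    hj₁≡i = trans (sym (omega-height j₁ r om)) r+1≡i

  right-not-last : ∀ j₀ → pos (right j₀) < n ℕ.+ n → suc (toℕ j₀) < n
  right-not-last j₀ lt =
    ℕP.+-cancelˡ-< n _ _ (subst (_< n ℕ.+ n) (trans (pos-right j₀) (sym (ℕP.+-suc n (toℕ j₀)))) lt)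

  right-last : ∀ j₀ → pos (right j₀) ≡ n ℕ.+ n → suc (toℕ j₀) ≡ n
  right-last j₀ e = ℕP.+-cancelˡ-≡ n _ _ (trans (ℕP.+-suc n (toℕ j₀)) (trans (sym (pos-right j₀)) e))

  right-next : ∀ j₀ j₁ → toℕ j₁ ≡ suc (toℕ j₀) → pos (right j₁) ≡ suc (pos (right j₀))
  right-next j₀ j₁ j₁≡ = cong suc (sym (right-adjacent j₁ j₀ j₁≡))

  clause1 : ∀ i j → n < pos i → pos i < n ℕ.+ n → (∀ c → pos c ≡ suc (pos i) → ¬ InJ B c) →
            pos j ≡ suc (pos i) → SigmaMaps N j i
  clause1 i j n<i i<2n notJ pj with right-of-pos i n<i
  ... | j₀ , refl = subst (λ c → SigmaMaps N c (right j₀)) (sym j≡)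
        (sigma (right j₀) (right j₁) (toℕ≢⇒right≢ (ℕP.1+n≢n ∘ trans (sym j₁≡)))
               (necklace-rightStep j₀ (right j₁) (inj₁ (j₁ , j₁≡ , same , refl))))
    where
    j₁ : Fin n
    j₁ = proj₁ (finAt (suc (toℕ j₀)) (right-not-last j₀ i<2n))
    j₁≡ : toℕ j₁ ≡ suc (toℕ j₀)
    j₁≡ = proj₂ (finAt (suc (toℕ j₀)) (right-not-last j₀ i<2n))
    j≡ : j ≡ right j₁
    j≡ = pos-injective (trans pj (sym (right-next j₀ j₁ j₁≡)))
    same : height j₁ ≡ height j₀
    same = decidable-stable (height j₁ ℕ.≟ height j₀)
             λ differ → notJ (right j₁) (right-next j₀ j₁ j₁≡) (height-inJ j₁ j₀ j₁≡ differ)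

  omega-step : ∀ j₀ r → (∀ j₁ → toℕ j₁ ≡ suc (toℕ j₀) → height j₁ ≢ height j₀) →
               IsOmega B (right j₀) r → SigmaMaps N (left r) (right j₀)
  omega-step j₀ r differ om =
    sigma (right j₀) (left r) (left≢right r j₀)
          (necklace-rightStep j₀ (left r) (inj₂ (differ , r , omega-height j₀ r om , refl)))

  clause2 : ∀ i j r → n < pos i → pos i < n ℕ.+ n → (∃[ c ] (pos c ≡ suc (pos i) × InJ B c)) →
            IsOmega B i r → pos j ≡ pos r → SigmaMaps N j i
  clause2 i j r n<i _ (c , pc , inJ) om pj with right-of-pos i n<i
  ... | j₀ , refl with right-of-pos c (subst (n <_) (sym pc) (ℕP.<-trans n<i ℕP.≤-refl))
  ...   | j₁ , refl = subst (λ c → SigmaMaps N c (right j₀)) (sym (pos-injective (trans pj (sym (pos-left r)))))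
                            (omega-step j₀ r differ om)
    where
    j₁≡ : toℕ j₁ ≡ suc (toℕ j₀)
    j₁≡ = ℕP.+-cancelˡ-≡ n _ _ (ℕP.suc-injective (trans (sym (pos-right j₁))
            (trans pc (cong suc (trans (pos-right j₀) (sym (ℕP.+-suc n (toℕ j₀))))))))
    differ : ∀ j₁' → toℕ j₁' ≡ suc (toℕ j₀) → height j₁' ≢ height j₀
    differ j₁' j₁'≡ = subst (λ j → height j ≢ height j₀) (FP.toℕ-injective (trans j₁≡ (sym j₁'≡)))
                        (inJ-height j₁ j₀ j₁≡ inJ)

  clause3 : ∀ i j r → pos i ≡ n ℕ.+ n → IsOmega B i r → pos j ≡ pos r → SigmaMaps N j i
  clause3 i j r pi om pj with right-of-pos i (subst (n <_) (sym pi) (ℕP.m<m+n n (nonempty i)))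
  ... | j₀ , refl = subst (λ c → SigmaMaps N c (right j₀)) (sym (pos-injective (trans pj (sym (pos-left r)))))
                          (omega-step j₀ r none om)
    where
    none : ∀ j₁ → toℕ j₁ ≡ suc (toℕ j₀) → height j₁ ≢ height j₀
    none j₁ j₁≡ _ = ℕP.<-irrefl (trans j₁≡ (right-last j₀ pi)) (FP.toℕ<n j₁)

  clause4 : ∀ i j → pos i ≡ 1 → pos j ≡ suc n → SigmaMaps N j i
  clause4 i j pi pj with left-of-pos i (subst (_≤ n) (sym pi) (nonempty i))
                       | right-of-pos j (subst (n <_) (sym pj) ℕP.≤-refl)
  ... | i₀ , refl | j₀ , refl =
    sigma (left i₀) (right j₀) (λ e → left≢right i₀ j₀ (sym e))
          (necklace-leftStep i₀ (right j₀) (inj₁ (i₀≡0 , j₀ , j₀≡0 , refl)))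
    where
    i₀≡0 : toℕ i₀ ≡ 0
    i₀≡0 = ℕP.suc-injective (trans (sym (pos-left i₀)) pi)
    j₀≡0 : toℕ j₀ ≡ 0
    j₀≡0 = ℕP.+-cancelˡ-≡ n _ _ (trans (ℕP.suc-injective (trans (sym (pos-right j₀)) pj)) (sym (ℕP.+-identityʳ n)))

  clause5 : ∀ i j → 1 < pos i → pos i ≤ n →
            ¬ (∃[ c ] ∃[ r ] (InJ B c × IsOmega B c r × pos r ≡ pos i ∸ 1)) →
            pos j ≡ pos i ∸ 1 → SigmaMaps N j i
  clause5 i j 1<i i≤n notω pj with left-of-pos i i≤n
  ... | i₀ , refl = subst (λ c → SigmaMaps N c (left i₀)) (sym j≡)
        (sigma (left i₀) (left r) (toℕ≢⇒left≢ (ℕP.<⇒≢ (subst (toℕ r <_) r+1≡i ℕP.≤-refl)))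
               (necklace-leftStep i₀ (left r) (inj₂ (inj₂ (1≤i , none , r , r+1≡i , refl)))))
    where
    1≤i : 1 ≤ toℕ i₀
    1≤i = ℕP.≤-pred (subst (1 <_) (pos-left i₀) 1<i)
    r : Fin n
    r = proj₁ (prevRow 1≤i (ℕP.<⇒≤ (FP.toℕ<n i₀)))
    r+1≡i : suc (toℕ r) ≡ toℕ i₀
    r+1≡i = proj₂ (prevRow 1≤i (ℕP.<⇒≤ (FP.toℕ<n i₀)))
    pos-r : pos r ≡ pos (left i₀) ∸ 1
    pos-r = trans r+1≡i (sym (cong (_∸ 1) (pos-left i₀)))
    j≡ : j ≡ left r
    j≡ = pos-injective (trans pj (trans (sym pos-r) (sym (pos-left r))))
    -- a column of height i would put its first column j₁ in J with ω(j₁) = i - 1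
    none : ∀ j' → height j' ≢ toℕ i₀
    none j' hj'≡i =
      notω (right j₁ , r , height-inJ j₁ j₁' j₁≡ differ , height-omega j₁ r (trans r+1≡i (sym hj₁≡i)) , pos-r)
      where
      c<n : cover (toℕ i₀) < n
      c<n = subst (_< n) (cong cover hj'≡i) (cover-height<n j')
      j₁ : Fin n
      j₁ = proj₁ (finAt (cover (toℕ i₀)) c<n)
      j₁≡c : toℕ j₁ ≡ cover (toℕ i₀)
      j₁≡c = proj₂ (finAt (cover (toℕ i₀)) c<n)
      hj₁≡i : height j₁ ≡ toℕ i₀
      hj₁≡i = trans (height-at-cover j' j₁ (trans j₁≡c (cong cover (sym hj'≡i)))) hj'≡i
      -- j₁ ≠ 0, since column 0 has height n > i
      j₁>0 : 0 < toℕ j₁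
      j₁>0 = ℕP.n≢0⇒n>0 λ j₁≡0 → ℕP.<-irrefl (trans (sym hj₁≡i) (height-first j₁ j₁≡0)) (FP.toℕ<n i₀)
      j₁' : Fin n
      j₁' = proj₁ (predecessor j₁ j₁>0)
      j₁≡ : toℕ j₁ ≡ suc (toℕ j₁')
      j₁≡ = proj₂ (predecessor j₁ j₁>0)
      differ : height j₁ ≢ height j₁'
      differ = ℕP.<⇒≢ (first-step⁻ j₁≡ (first-at-cover j₁ (toℕ i₀) j₁≡c))

  clause6 : ∀ i j r → 1 < pos i → pos i ≤ n → InJ B j → IsOmega B j r → pos r ≡ pos i ∸ 1 → SigmaMaps N j i
  clause6 i j r 1<i i≤n inJ om pr with left-of-pos i i≤n
  ... | i₀ , refl with omega-of-J (toℕ i₀) j r inJ om (trans pr (cong (_∸ 1) (pos-left i₀)))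
  ...   | j₁ , refl , hj₁≡i , j₁≡c =
    sigma (left i₀) (right j₁) (λ e → left≢right i₀ j₁ (sym e))
          (necklace-leftStep i₀ (right j₁) (inj₂ (inj₁ (1≤i , j₁ , hj₁≡i , j₁≡c , refl))))
    where
    1≤i : 1 ≤ toℕ i₀
    1≤i = ℕP.≤-pred (subst (1 <_) (pos-left i₀) 1<i)

  clause7 : ∀ (i : Fin (n ℕ.+ n)) j j' r → 1 < pos i → pos i ≤ n → InJ B j → InJ B j' →
            IsOmega B j r → IsOmega B j' r → pos r ≡ pos i ∸ 1 → j ≡ j'
  clause7 i j j' r _ _ inJ inJ' om om' pr
    with omega-of-J (pos i ∸ 1) j r inJ om pr | omega-of-J (pos i ∸ 1) j' r inJ' om' pr
  ... | j₁ , refl , _ , j₁≡c | j₁' , refl , _ , j₁'≡c =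
    cong right (FP.toℕ-injective (trans j₁≡c (sym j₁'≡c)))

open import Data.Nat using (ℕ; suc; _+_; _∸_; _<_; _≤_)
open import Data.Fin using (Fin; toℕ)
open import Data.Fin.Subset using (Subset)
open import Data.Rational using (ℚ)
open import Data.Product using (_×_; ∃; ∃-syntax; _,_)
open import Relation.Nullary using (¬_)
open import Relation.Binary.PropositionalEquality using (_≡_)

proposition4p3 : ∀ (n : ℕ) (A : Fin n → Fin n → ℚ) → IsDyck A →
  ∀ (N : Fin (n + n) → Subset (n + n)) →
  (∀ i → IsLexMinBasis (psi A) i (N i)) →
  -- π(i) = i+1  if n < i < 2n and i+1 ∉ J
  (∀ i j → n < pos i → pos i < n + n →
    (∀ c → pos c ≡ suc (pos i) → ¬ InJ (psi A) c) →
    pos j ≡ suc (pos i) → SigmaMaps N j i) ×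
  -- π(i) = ω(i)  if n < i < 2n and i+1 ∈ J
  (∀ i j r → n < pos i → pos i < n + n →
    (∃[ c ] (pos c ≡ suc (pos i) × InJ (psi A) c)) →
    IsOmega (psi A) i r → pos j ≡ pos r → SigmaMaps N j i) ×
  -- π(i) = ω(i)  if i = 2n
  (∀ i j r → pos i ≡ n + n →
    IsOmega (psi A) i r → pos j ≡ pos r → SigmaMaps N j i) ×
  -- π(1) = n+1
  (∀ i j → pos i ≡ 1 → pos j ≡ suc n → SigmaMaps N j i) ×
  -- π(i) = i-1  if 1 < i ≤ n and i-1 ∉ ω(J)
  (∀ i j → 1 < pos i → pos i ≤ n →
    ¬ (∃[ c ] ∃[ r ] (InJ (psi A) c × IsOmega (psi A) c r × pos r ≡ pos i ∸ 1)) →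
    pos j ≡ pos i ∸ 1 → SigmaMaps N j i) ×
  -- π(i) = j  if 1 < i ≤ n and i-1 = ω(j) with j ∈ J
  (∀ i j r → 1 < pos i → pos i ≤ n →
    InJ (psi A) j → IsOmega (psi A) j r → pos r ≡ pos i ∸ 1 → SigmaMaps N j i) ×
  -- the j in the last case is unique
  (∀ (i : Fin (n + n)) j j' r → 1 < pos i → pos i ≤ n → InJ (psi A) j → InJ (psi A) j' →
    IsOmega (psi A) j r → IsOmega (psi A) j' r → pos r ≡ pos i ∸ 1 → j ≡ j')
proposition4p3 n A dyck N lexMin =
  clause1 , clause2 , clause3 , clause4 , clause5 , clause6 , clause7
  where open Clauses n A dyck N lexMin
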